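{- Let $m\ge1$, $q=2^m$, $k=\mathbb F_q$, $k_2=\mathbb F_{q^2}$, $a\in k^*$, $b,c\in k$, and with notation as in the context assume $\tilde V=\tilde W$. Then the sign of $\tilde Q$ as a quadratic form on $k_2/\tilde W$ coincides with the sign of $\tilde Q$ as a quadratic form on $U/(k+\tilde W)$.
   Context: $E_{ab}(x)=a^4x^{16}+b^4x^8+b^2x^2+ax$, $\tilde W$ = set of roots of $E_{ab}$ in $k_2$. $R(x)=ax^4+bx^2+c^2x$, $\langle x,y\rangle_R=\operatorname{Tr}_{k_2/\mathbb F_2}(xR(y)+yR(x))$, a symplectic form on $k_2$ with radical $\tilde W$. $\tilde Q(x)=\operatorname{Tr}_{k_2/\mathbb F_2}(ax^5+bx^3+cx)$ satisfies $\tilde Q(x+y)=\tilde Q(x)+\tilde Q(y)+\langle x,y\rangle_R$; $\tilde V$ is the kernel of the linear form $\tilde Q|_{\tilde W}$. When $\tilde V=\tilde W$, $\tilde Q$ descends to a quadratic form on $k_2/\tilde W$ with nondegenerate polar form. $U=\{u\in k_2:\langle u,\lambda\rangle_R=0\ \forall\lambda\in k\}$; it contains $k+\tilde W$, and when $\tilde V=\tilde W$, $\tilde Q$ is constant on cosets of $k+\tilde W$ in $U$ and induces a quadratic form on $U/(k+\tilde W)$ with nondegenerate polar form. Sign convention: a quadratic form on an $\mathbb F_2$-space of dimension $2n$ with nondegenerate polar form has either $2^{n-1}(2^n+1)$ zeros (sign $+$) or $2^{n-1}(2^n-1)$ zeros (sign $-$); for $n=0$ the sign is $+$. -}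

module Defs where

open import Level using (0ℓ)
open import Data.Nat as ℕ using (ℕ; zero; suc)
open import Data.Bool using (Bool; true; false; _∧_; _∨_; not)
open import Data.List using (List; []; _∷_; length; filterᵇ; upTo; foldr; map)
open import Data.Bool.ListAction using (all; any)
open import Data.List.Relation.Unary.Unique.Propositional using (Unique)
open import Data.List.Membership.Propositional using (_∈_)
open import Data.Product using (Σ; _×_)
open import Relation.Binary.PropositionalEquality using (_≡_; _≢_)
open import Relation.Binary.Definitions using (DecidableEquality)
open import Relation.Nullary.Decidable using (⌊_⌋)
open import Algebra.Structures using (IsCommutativeRing)

-- A finite field with exactly 4^m = q^2 elements (q = 2^m), i.e. a model
-- of k₂ = 𝔽_{q²}.

record FiniteField4^ (m : ℕ) : Set₁ where
  infixl 6 _+_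
  infixl 7 _*_
  field
    Carrier   : Set
    _+_ _*_   : Carrier → Carrier → Carrier
    -_        : Carrier → Carrier
    0# 1#     : Carrier
    isCommutativeRing : IsCommutativeRing _≡_ _+_ _*_ -_ 0# 1#
    0≢1       : 0# ≢ 1#
    inverse   : ∀ x → x ≢ 0# → Σ Carrier (λ y → x * y ≡ 1#)
    _≟_       : DecidableEquality Carrier
    elems     : List Carrier
    elems-unique   : Unique elems
    elems-complete : ∀ x → x ∈ elems
    card      : length elems ≡ 4 ℕ.^ m

module Setup {m : ℕ} (F : FiniteField4^ m) where
  open FiniteField4^ F

  infixr 8 _^_
  _^_ : Carrier → ℕ → Carrier
  x ^ zero  = 1#
  x ^ suc n = x * (x ^ n)

  q : ℕ
  q = 2 ℕ.^ m

  -- k = 𝔽_q ⊆ k₂ : the fixed field of x ↦ x^q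
  inK : Carrier → Bool
  inK x = ⌊ (x ^ q) ≟ x ⌋

  isZero : Carrier → Bool
  isZero x = ⌊ x ≟ 0# ⌋

  -- absolute trace Tr_{k₂/𝔽₂}(x) = Σ_{i<2m} x^(2^i)  (a value in {0,1} ⊆ k₂)
  Tr : Carrier → Carrier
  Tr x = foldr _+_ 0# (map (λ i → x ^ (2 ℕ.^ i)) (upTo (2 ℕ.* m)))

  count : (Carrier → Bool) → ℕ
  count P = length (filterᵇ P elems)

  module Forms (a b c : Carrier) where

    E : Carrier → Carrier
    E x = (a ^ 4) * (x ^ 16) + (b ^ 4) * (x ^ 8) + (b ^ 2) * (x ^ 2) + a * x

    inW : Carrier → Bool
    inW x = isZero (E x)

    R : Carrier → Carrier
    R x = a * (x ^ 4) + b * (x ^ 2) + (c ^ 2) * x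

    ⟨_,_⟩ : Carrier → Carrier → Carrier
    ⟨ x , y ⟩ = Tr (x * R y + y * R x)

    Q̃ : Carrier → Carrier
    Q̃ x = Tr (a * (x ^ 5) + b * (x ^ 3) + c * x)

    -- Ṽ = W̃ : Q̃ vanishes on W̃
    V≡W : Set
    V≡W = ∀ w → E w ≡ 0# → Q̃ w ≡ 0#

    inU : Carrier → Bool
    inU u = all (λ l → not (inK l) ∨ isZero ⟨ u , l ⟩) elems

    inKW : Carrier → Bool
    inKW x = any (λ l → inK l ∧ inW (x + (- l))) elems

-- Sign of a quadratic form on a quotient A/B of finite 𝔽₂-spaces,
-- given by counts:  cardA = |A|, cardB = |B|, zeros = #{x ∈ A : Q x = 0}
-- (Q constant on cosets of B).  The quotient has dimension 2n iff
-- |A| = 4^n |B|, and the number of zeros on A/B is zeros/|B|.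
-- Sign + : zeros/|B| = 2^{n-1}(2^n+1), i.e. 2·zeros = (4^n + 2^n)|B|.
-- Sign − : zeros/|B| = 2^{n-1}(2^n−1), i.e. 2·zeros + 2^n|B| = 4^n|B|.

data Sign : Set where
  plus minus : Sign

HasSign : (cardA cardB zeros : ℕ) → Sign → Set
HasSign cardA cardB zeros plus =
  Σ ℕ λ n → cardA ≡ 4 ℕ.^ n ℕ.* cardB × 2 ℕ.* zeros ≡ (4 ℕ.^ n ℕ.+ 2 ℕ.^ n) ℕ.* cardB
HasSign cardA cardB zeros minus =
  Σ ℕ λ n → cardA ≡ 4 ℕ.^ n ℕ.* cardB × 2 ℕ.* zeros ℕ.+ 2 ℕ.^ n ℕ.* cardB ≡ 4 ℕ.^ n ℕ.* cardB

module Submission where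

-- Write χ(t) = (-1)^t. Both signs are read off from character sums: the count of zeros of Q̃ on
-- A/B determines ∑_{x ∈ A} χ(Q̃ x). These sums agree for A = k₂ and A = U: for λ ∈ k one has
-- Q̃(x + λ) = Q̃ x + ⟨x, λ⟩, so averaging ∑_x χ(Q̃ x) over the translations by k brings in
-- ∑_{λ ∈ k} χ⟨x, λ⟩, which is |k| on U and 0 off U. Moreover U is the orthogonal of k + W̃ and W̃
-- is the radical of ⟨_,_⟩, so |k + W̃| · |U| = |k₂| · |W̃|; as all these groups have 2-power
-- order, elementary arithmetic transfers the dimension and the sign from one quotient to the other.

open import Defs
open import Data.Nat as ℕ using (ℕ; zero; suc; _≤_; _<_; z≤n; s≤s)
import Data.Nat.Properties as ℕP
open import Algebra.Properties.CommutativeSemigroup ℕP.+-commutativeSemigroup using () renaming (xy∙z≈xz∙y to +-right-comm)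
open import Data.Nat.Divisibility using (_∣_; divides; ∣⇒≤; ∣1⇒≡1; 0∣⇒≡0; *-cancelʳ-∣; _∣?_)
open import Data.Nat.Coprimality using (Coprime; coprime-divisor)
open import Data.Nat.Tactic.RingSolver as ℕ-Solver using ()
open import Data.Integer using (ℤ; 0ℤ; 1ℤ; -1ℤ)
  renaming (+_ to pos; _+_ to _+ℤ_; _*_ to _*ℤ_; -_ to -ℤ_)
import Data.Integer.Properties as ℤP
open import Algebra.Properties.CommutativeSemigroup ℤP.+-commutativeSemigroup using () renaming (interchange to +ℤ-interchange)
open import Data.Integer.Tactic.RingSolver as ℤ-Solver using ()
open import Data.Bool using (Bool; true; false; _∧_; _∨_; not; T; if_then_else_)
open import Data.Bool.Properties using (T?; T-∧; T-≡)
open import Data.List using (List; []; _∷_; length; filterᵇ; foldr; map; applyUpTo)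
open import Data.List.Membership.Propositional using (_∈_)
open import Data.List.Relation.Unary.Any as AnyList using (here; there; any?; satisfied)
import Data.List.Relation.Unary.All as All
open import Data.List.Relation.Unary.All.Properties using (all⁺; all⁻; ¬All⇒Any¬)
open import Data.List.Relation.Unary.Any.Properties using (any⁺; any⁻)
open import Data.Bool.ListAction using (all)
open import Data.List.Relation.Unary.Unique.Propositional using (Unique)
open import Data.List.Properties using (filter-all; filter-none; filter-some; filter-≐)
import Data.List.Relation.Unary.AllPairs as AllPairs
open import Data.List.Relation.Binary.Permutation.Propositional using (_↭_; ↭⇒↭ₛ)
open import Data.List.Relation.Binary.Permutation.Propositional.Properties using (map⁺)
import Data.List.Relation.Binary.Permutation.Setoid.Properties as ↭ₛ
open import Data.List.Relation.Binary.BagAndSetEquality using (∼bag⇒↭)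
open import Data.List.Membership.Propositional.Properties using (∈-map⁺; ∈-map⁻; ∈-filter⁺; ∈-filter⁻)
open import Data.List.Membership.Propositional.Properties.WithK using (unique∧set⇒bag)
import Data.List.Relation.Unary.Unique.Propositional.Properties as Unique
open import Data.List.Relation.Binary.Sublist.Propositional.Properties using (filter⁺; length-mono-≤)
open import Data.List.Relation.Binary.Sublist.Propositional using (⊆-refl)
open import Algebra.Bundles using (CommutativeRing)
open import Algebra.Structures using (IsCommutativeRing)
import Algebra.Properties.Semiring.Mult as Mult
import Algebra.Solver.Ring.NaturalCoefficients as NaturalCoefficients
open import Data.Maybe as Maybe using (Maybe; just; nothing)
import Algebra.Properties.CommutativeSemigroup as CommSemigroupProps
import Algebra.Properties.Group as GroupProperties
open import Data.Vec as Vec using (Vec; []; _∷_)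
open import Data.Vec.Relation.Unary.All as VecAll using ([]; _∷_)
open import Data.Product using (∃-syntax; _×_; _,_; proj₁; proj₂)
open import Data.Sum using (_⊎_; inj₁; inj₂; [_,_]′)
open import Data.Empty using (⊥-elim)
open import Function using (_∘_)
open import Function.Bundles using (_⇔_; mk⇔; Equivalence)
open import Relation.Nullary using (¬_; yes; no)
open import Relation.Nullary.Decidable using (⌊_⌋; toWitness; fromWitness; toWitnessFalse; fromWitnessFalse)
open import Relation.Binary.Definitions using (DecidableEquality)
open import Relation.Binary.PropositionalEquality

module _ {A : Set} where

  map-inverse-↭ : (xs : List A) → Unique xs → (f g : A → A) →
    (∀ x → g (f x) ≡ x) → (∀ x → f (g x) ≡ x) →
    (∀ {x} → x ∈ xs → f x ∈ xs) → (∀ {x} → x ∈ xs → g x ∈ xs) → map f xs ↭ xs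
  map-inverse-↭ xs xs! f g gf fg f∈ g∈ =
    ∼bag⇒↭ (unique∧set⇒bag (Unique.map⁺ f-injective xs!) xs! (mk⇔ to from))
    where
    f-injective : ∀ {x y} → f x ≡ f y → x ≡ y
    f-injective {x} {y} e = trans (sym (gf x)) (trans (cong g e) (gf y))
    to : ∀ {x} → x ∈ map f xs → x ∈ xs
    to x∈ with ∈-map⁻ f x∈
    ... | _ , y∈ , refl = f∈ y∈
    from : ∀ {x} → x ∈ xs → x ∈ map f xs
    from {x} x∈ = subst (_∈ map f xs) (fg x) (∈-map⁺ f (g∈ x∈))

  count-mono : (p p′ : A → Bool) (xs : List A) → (∀ {x} → T (p x) → T (p′ x)) →
    length (filterᵇ p xs) ≤ length (filterᵇ p′ xs)
  count-mono p p′ xs p⇒p′ = length-mono-≤ (filter⁺ (T? ∘ p) (T? ∘ p′) (λ { refl → p⇒p′ }) (⊆-refl {x = xs}))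

  count-true : (xs : List A) → length (filterᵇ (λ _ → true) xs) ≡ length xs
  count-true xs = cong length (filter-all (T? ∘ λ _ → true) (All.universal _ xs))

  count-cong : (p p′ : A → Bool) (xs : List A) → (∀ x → T (p x) ⇔ T (p′ x)) →
    length (filterᵇ p xs) ≡ length (filterᵇ p′ xs)
  count-cong p p′ xs p⇔p′ =
    cong length (filter-≐ (T? ∘ p) (T? ∘ p′) ((Equivalence.to ∘ p⇔p′) _ , (Equivalence.from ∘ p⇔p′) _) xs)

  ∈⇒length≡suc : ∀ {x : A} {xs} → x ∈ xs → ∃[ n ] length xs ≡ suc n
  ∈⇒length≡suc {xs = _ ∷ xs} _ = length xs , refl

  count-split : (p : A → Bool) (xs : List A) →
    length (filterᵇ p xs) ℕ.+ length (filterᵇ (not ∘ p) xs) ≡ length xs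
  count-split p [] = refl
  count-split p (x ∷ xs) with p x
  ... | true  = cong suc (count-split p xs)
  ... | false = trans (ℕP.+-suc _ _) (cong suc (count-split p xs))

  count-≟ : (_≟_ : DecidableEquality A) {z : A} {xs : List A} → Unique xs → z ∈ xs →
    length (filterᵇ (λ x → ⌊ x ≟ z ⌋) xs) ≡ 1
  count-≟ _≟_ {z} (z∉xs AllPairs.∷ _) (here refl) with z ≟ z
  ... | yes _  = cong suc (cong length (filter-none (T? ∘ λ x → ⌊ x ≟ z ⌋) (All.map (λ z≢y → z≢y ∘ sym ∘ toWitness) z∉xs)))
  ... | no z≢z = ⊥-elim (z≢z refl)
  count-≟ _≟_ {z} {x ∷ xs} (x∉xs AllPairs.∷ xs!) (there z∈xs) with x ≟ z
  ... | yes refl = ⊥-elim (All.lookup x∉xs z∈xs refl)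
  ... | no _     = count-≟ _≟_ xs! z∈xs

𝟙 : Bool → ℤ
𝟙 true  = 1ℤ
𝟙 false = 0ℤ

𝟙-∧ : ∀ b c → 𝟙 (b ∧ c) ≡ 𝟙 b *ℤ 𝟙 c
𝟙-∧ true  true  = refl
𝟙-∧ true  false = refl
𝟙-∧ false c     = refl

i≡-i⇒i≡0 : ∀ i → i ≡ -ℤ i → i ≡ 0ℤ
i≡-i⇒i≡0 (pos zero) _ = refl

2x-a≡2y-b⇒2x+b≡2y+a : ∀ x a y b → pos 2 *ℤ pos x +ℤ -ℤ pos a ≡ pos 2 *ℤ pos y +ℤ -ℤ pos b →
  2 ℕ.* x ℕ.+ b ≡ 2 ℕ.* y ℕ.+ a
2x-a≡2y-b⇒2x+b≡2y+a x a y b eq = ℤP.+-injective (begin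
  pos (2 ℕ.* x ℕ.+ b)                        ≡⟨ ℤP.pos-+ (2 ℕ.* x) b ⟩
  pos (2 ℕ.* x) +ℤ pos b                     ≡⟨ cong (_+ℤ pos b) (ℤP.pos-* 2 x) ⟩
  pos 2 *ℤ pos x +ℤ pos b                    ≡⟨ move-neg (pos 2 *ℤ pos x) (pos a) (pos b) ⟩
  (pos 2 *ℤ pos x +ℤ -ℤ pos a) +ℤ (pos a +ℤ pos b) ≡⟨ cong (_+ℤ (pos a +ℤ pos b)) eq ⟩
  (pos 2 *ℤ pos y +ℤ -ℤ pos b) +ℤ (pos a +ℤ pos b) ≡⟨ move-neg′ (pos 2 *ℤ pos y) (pos a) (pos b) ⟩
  pos 2 *ℤ pos y +ℤ pos a                    ≡⟨ cong (_+ℤ pos a) (ℤP.pos-* 2 y) ⟨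
  pos (2 ℕ.* y) +ℤ pos a                     ≡⟨ ℤP.pos-+ (2 ℕ.* y) a ⟨
  pos (2 ℕ.* y ℕ.+ a)                        ∎)
  where
  open ≡-Reasoning
  move-neg : ∀ i j k → i +ℤ k ≡ (i +ℤ -ℤ j) +ℤ (j +ℤ k)
  move-neg = ℤ-Solver.solve-∀
  move-neg′ : ∀ i j k → (i +ℤ -ℤ k) +ℤ (j +ℤ k) ≡ i +ℤ j
  move-neg′ = ℤ-Solver.solve-∀

module _ {A : Set} where

  ∑ : List A → (A → ℤ) → ℤ
  ∑ xs f = foldr _+ℤ_ 0ℤ (map f xs)

  ∑-↭ : ∀ {xs ys} (f : A → ℤ) → xs ↭ ys → ∑ xs f ≡ ∑ ys f
  ∑-↭ f p = ↭ₛ.foldr-commMonoid (setoid ℤ) ℤP.+-0-isCommutativeMonoid (↭⇒↭ₛ (map⁺ f p))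

  ∑-map : ∀ xs (g : A → A) f → ∑ (map g xs) f ≡ ∑ xs (f ∘ g)
  ∑-map []       g f = refl
  ∑-map (x ∷ xs) g f = cong (f (g x) +ℤ_) (∑-map xs g f)

  ∑-cong : ∀ xs {f g : A → ℤ} → (∀ {x} → x ∈ xs → f x ≡ g x) → ∑ xs f ≡ ∑ xs g
  ∑-cong []       f≗g = refl
  ∑-cong (x ∷ xs) f≗g = cong₂ _+ℤ_ (f≗g (here refl)) (∑-cong xs (f≗g ∘ there))

  ∑-*ˡ : ∀ xs c f → ∑ xs (λ x → c *ℤ f x) ≡ c *ℤ ∑ xs f
  ∑-*ˡ []       c f = sym (ℤP.*-zeroʳ c)
  ∑-*ˡ (x ∷ xs) c f = trans (cong (c *ℤ f x +ℤ_) (∑-*ˡ xs c f)) (sym (ℤP.*-distribˡ-+ c (f x) _))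

  ∑-neg : ∀ xs f → ∑ xs (λ x → -ℤ f x) ≡ -ℤ ∑ xs f
  ∑-neg []       f = refl
  ∑-neg (x ∷ xs) f = trans (cong (-ℤ f x +ℤ_) (∑-neg xs f)) (sym (ℤP.neg-distrib-+ (f x) _))

  ∑-+ : ∀ xs f g → ∑ xs (λ x → f x +ℤ g x) ≡ ∑ xs f +ℤ ∑ xs g
  ∑-+ []       f g = refl
  ∑-+ (x ∷ xs) f g =
    trans (cong (f x +ℤ g x +ℤ_) (∑-+ xs f g)) (+ℤ-interchange (f x) (g x) (∑ xs f) (∑ xs g))

  ∑-0 : ∀ xs → ∑ xs (λ _ → 0ℤ) ≡ 0ℤ
  ∑-0 []       = refl
  ∑-0 (_ ∷ xs) = trans (ℤP.+-identityˡ _) (∑-0 xs)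

  ∑-comm : ∀ xs ys (h : A → A → ℤ) → ∑ xs (λ x → ∑ ys (h x)) ≡ ∑ ys (λ y → ∑ xs (λ x → h x y))
  ∑-comm []       ys h = sym (∑-0 ys)
  ∑-comm (x ∷ xs) ys h =
    trans (cong (∑ ys (h x) +ℤ_) (∑-comm xs ys h)) (sym (∑-+ ys (h x) (λ y → ∑ xs (λ x′ → h x′ y))))

  ∑-𝟙 : ∀ xs p → ∑ xs (𝟙 ∘ p) ≡ pos (length (filterᵇ p xs))
  ∑-𝟙 []       p = refl
  ∑-𝟙 (x ∷ xs) p with p x
  ... | true  = cong (1ℤ +ℤ_) (∑-𝟙 xs p)
  ... | false = trans (ℤP.+-identityˡ _) (∑-𝟙 xs p)

module _ where
  open import Data.Nat using (_+_; _*_; _^_; _∸_)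

  odd⇒coprime-2 : ∀ d → ¬ (2 ∣ d) → Coprime d 2
  odd⇒coprime-2 d 2∤d {zero}                (_ , 0∣2) with () ← 0∣⇒≡0 0∣2
  odd⇒coprime-2 d 2∤d {suc zero}            _ = refl
  odd⇒coprime-2 d 2∤d {suc (suc zero)}      (2∣d , _) = ⊥-elim (2∤d 2∣d)
  odd⇒coprime-2 d 2∤d {suc (suc (suc i))}   (_ , i∣2) with s≤s (s≤s ()) ← ∣⇒≤ i∣2

  ∣2^⇒≡2^ : ∀ k d → d ∣ 2 ^ k → ∃[ j ] d ≡ 2 ^ j
  ∣2^⇒≡2^ zero    d d∣1 = 0 , ∣1⇒≡1 d∣1
  ∣2^⇒≡2^ (suc k) d d∣2^k+1 with 2 ∣? d
  ... | yes (divides e refl) =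
    let j , e≡2^j = ∣2^⇒≡2^ k e (*-cancelʳ-∣ 2 (subst (e * 2 ∣_) (ℕP.*-comm 2 (2 ^ k)) d∣2^k+1))
    in suc j , trans (ℕP.*-comm e 2) (cong (2 *_) e≡2^j)
  ... | no 2∤d = ∣2^⇒≡2^ k d (coprime-divisor (odd⇒coprime-2 d 2∤d) d∣2^k+1)

  2^-cancel-≤ : ∀ i j → 2 ^ i ≤ 2 ^ j → i ≤ j
  2^-cancel-≤ i j 2^i≤2^j with ℕP.≤-<-connex i j
  ... | inj₁ i≤j = i≤j
  ... | inj₂ j<i = ⊥-elim (ℕP.<⇒≱ (ℕP.^-monoʳ-< 2 (s≤s (s≤s z≤n)) j<i) 2^i≤2^j)

  2^-injective : ∀ i j → 2 ^ i ≡ 2 ^ j → i ≡ j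
  2^-injective i j e = ℕP.≤-antisym (2^-cancel-≤ i j (ℕP.≤-reflexive e)) (2^-cancel-≤ j i (ℕP.≤-reflexive (sym e)))

  4^≡2^2* : ∀ n → 4 ^ n ≡ 2 ^ (2 * n)
  4^≡2^2* = ℕP.^-*-assoc 2 2

  2^-+ : ∀ i j → 2 ^ (i + j) ≡ 2 ^ i * 2 ^ j
  2^-+ = ℕP.^-distribˡ-+-* 2

  4^*2^ : ∀ i j → 4 ^ i * 2 ^ j ≡ 2 ^ (2 * i + j)
  4^*2^ i j = trans (cong (_* 2 ^ j) (ℕP.^-*-assoc 2 2 i)) (sym (2^-+ (2 * i) j))

-- Signs of quadratic forms, read off from counts

  dimension-transfer : ∀ {A B A′ B′} n → A ≡ 4 ^ n * B →
    ∃[ b ] B ≡ 2 ^ b → ∃[ a′ ] A′ ≡ 2 ^ a′ → ∃[ b′ ] B′ ≡ 2 ^ b′ →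
    B′ * A′ ≡ A * B → B′ ≤ A′ →
    ∃[ n′ ] A′ ≡ 4 ^ n′ * B′ × 2 ^ n * B ≡ 2 ^ n′ * B′
  dimension-transfer n refl (b , refl) (a′ , refl) (b′ , refl) B′A′≡AB B′≤A′ =
    n′ , trans (cong (2 ^_) a′≡2n′+b′) (sym (4^*2^ n′ b′)) ,
    trans (sym (2^-+ n b)) (trans (cong (2 ^_) (sym n′+b′≡n+b)) (2^-+ n′ b′))
    where
    double-+ : ∀ i j → 2 * i + (j + j) ≡ 2 * (i + j)
    double-+ = ℕ-Solver.solve-∀
    double-+′ : ∀ i j → 2 * (i + j) ≡ j + (2 * i + j)
    double-+′ = ℕ-Solver.solve-∀
    b′+a′≡2[n+b] : b′ + a′ ≡ 2 * (n + b)
    b′+a′≡2[n+b] = 2^-injective _ _ (begin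
      2 ^ (b′ + a′)               ≡⟨ 2^-+ b′ a′ ⟩
      2 ^ b′ * 2 ^ a′             ≡⟨ B′A′≡AB ⟩
      4 ^ n * 2 ^ b * 2 ^ b       ≡⟨ ℕP.*-assoc (4 ^ n) (2 ^ b) (2 ^ b) ⟩
      4 ^ n * (2 ^ b * 2 ^ b)     ≡⟨ cong (4 ^ n *_) (sym (2^-+ b b)) ⟩
      4 ^ n * 2 ^ (b + b)         ≡⟨ 4^*2^ n (b + b) ⟩
      2 ^ (2 * n + (b + b))       ≡⟨ cong (2 ^_) (double-+ n b) ⟩
      2 ^ (2 * (n + b))           ∎)
      where open ≡-Reasoning
    b′≤n+b : b′ ≤ n + b
    b′≤n+b = ℕP.*-cancelˡ-≤ 2 (ℕP.≤-trans (ℕP.≤-reflexive (cong (b′ +_) (ℕP.+-identityʳ b′)))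
      (ℕP.≤-trans (ℕP.+-monoʳ-≤ b′ (2^-cancel-≤ b′ a′ B′≤A′)) (ℕP.≤-reflexive b′+a′≡2[n+b])))
    n′ : ℕ
    n′ = n + b ∸ b′
    n′+b′≡n+b : n′ + b′ ≡ n + b
    n′+b′≡n+b = ℕP.m∸n+n≡m b′≤n+b
    a′≡2n′+b′ : a′ ≡ 2 * n′ + b′
    a′≡2n′+b′ = ℕP.+-cancelˡ-≡ b′ a′ _ (trans b′+a′≡2[n+b]
      (trans (cong (2 *_) (sym n′+b′≡n+b)) (double-+′ n′ b′)))

  plus-transfer : ∀ {A A′ X Z Z′} → 2 * Z + A′ ≡ 2 * Z′ + A → 2 * Z ≡ A + X → 2 * Z′ ≡ A′ + X
  plus-transfer {A} {A′} {X} {Z} {Z′} hS hZ = ℕP.+-cancelʳ-≡ A _ _ (begin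
    2 * Z′ + A    ≡⟨ sym hS ⟩
    2 * Z + A′    ≡⟨ cong (_+ A′) hZ ⟩
    A + X + A′    ≡⟨ shuffle A X A′ ⟩
    A′ + X + A    ∎)
    where
    open ≡-Reasoning
    shuffle : ∀ a x a′ → a + x + a′ ≡ a′ + x + a
    shuffle = ℕ-Solver.solve-∀

  minus-transfer : ∀ {A A′ X Z Z′} → 2 * Z + A′ ≡ 2 * Z′ + A → 2 * Z + X ≡ A → 2 * Z′ + X ≡ A′
  minus-transfer {A} {A′} {X} {Z} {Z′} hS hZ = ℕP.+-cancelʳ-≡ A _ _ (begin
    2 * Z′ + X + A    ≡⟨ +-right-comm (2 * Z′) X A ⟩
    2 * Z′ + A + X    ≡⟨ cong (_+ X) (sym hS) ⟩
    2 * Z + A′ + X    ≡⟨ +-right-comm (2 * Z) A′ X ⟩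
    2 * Z + X + A′    ≡⟨ cong (_+ A′) hZ ⟩
    A + A′            ≡⟨ ℕP.+-comm A A′ ⟩
    A′ + A            ∎)
    where open ≡-Reasoning

  HasSign-transfer : ∀ {A B A′ B′ Z Z′} s →
    ∃[ b ] B ≡ 2 ^ b → ∃[ a′ ] A′ ≡ 2 ^ a′ → ∃[ b′ ] B′ ≡ 2 ^ b′ →
    B′ * A′ ≡ A * B → B′ ≤ A′ → 2 * Z + A′ ≡ 2 * Z′ + A →
    HasSign A B Z s → HasSign A′ B′ Z′ s
  HasSign-transfer {A} {B} {A′} {B′} {Z} {Z′} plus B-pow A′-pow B′-pow B′A′≡AB B′≤A′ hS (n , hA , hZ)
    with dimension-transfer n hA B-pow A′-pow B′-pow B′A′≡AB B′≤A′
  ... | n′ , hA′ , hX = n′ , hA′ , (begin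
    2 * Z′                      ≡⟨ plus-transfer {A} {A′} {2 ^ n * B} {Z} {Z′} hS (trans hZ (trans (ℕP.*-distribʳ-+ B (4 ^ n) (2 ^ n)) (cong (_+ 2 ^ n * B) (sym hA)))) ⟩
    A′ + 2 ^ n * B              ≡⟨ cong₂ _+_ hA′ hX ⟩
    4 ^ n′ * B′ + 2 ^ n′ * B′   ≡⟨ ℕP.*-distribʳ-+ B′ (4 ^ n′) (2 ^ n′) ⟨
    (4 ^ n′ + 2 ^ n′) * B′      ∎)
    where open ≡-Reasoning
  HasSign-transfer {A} {B} {A′} {B′} {Z} {Z′} minus B-pow A′-pow B′-pow B′A′≡AB B′≤A′ hS (n , hA , hZ)
    with dimension-transfer n hA B-pow A′-pow B′-pow B′A′≡AB B′≤A′
  ... | n′ , hA′ , hX =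
    n′ , hA′ , subst₂ (λ x a′ → 2 * Z′ + x ≡ a′) hX hA′ (minus-transfer {A} {A′} {2 ^ n * B} {Z} {Z′} hS (trans hZ (sym hA)))

-- The field k₂

module Field {m : ℕ} (F : FiniteField4^ m) where
  open FiniteField4^ F public
  open Setup F public
  open IsCommutativeRing isCommutativeRing public
    using (+-assoc; +-comm; +-identityˡ; +-identityʳ; *-assoc; *-comm; *-identityˡ; *-identityʳ;
           distribˡ; distribʳ; zeroˡ; zeroʳ; -‿inverseˡ; -‿inverseʳ;
           +-isCommutativeMonoid; *-isCommutativeMonoid)

  commutativeRing : CommutativeRing _ _
  commutativeRing = record { isCommutativeRing = isCommutativeRing }

  open CommutativeRing commutativeRing using (semiring; commutativeSemiring; +-group; +-commutativeSemigroup; *-commutativeSemigroup)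
  open GroupProperties +-group using (identityʳ-unique; inverseʳ-unique)
  open CommSemigroupProps +-commutativeSemigroup using () renaming (interchange to +-interchange)
  open CommSemigroupProps *-commutativeSemigroup using () renaming (interchange to *-interchange)

  open Mult semiring using (×1-homo-*) renaming (_×_ to _·_)

  N : ℕ
  N = length elems

  ∑ᶠ : List Carrier → Carrier
  ∑ᶠ = foldr _+_ 0#

  ∏ᶠ : List Carrier → Carrier
  ∏ᶠ = foldr _*_ 1#

  x*y≡0⇒x≡0⊎y≡0 : ∀ x y → x * y ≡ 0# → x ≡ 0# ⊎ y ≡ 0#
  x*y≡0⇒x≡0⊎y≡0 x y xy≡0 with x ≟ 0#
  ... | yes x≡0 = inj₁ x≡0
  ... | no x≢0 with inverse x x≢0
  ... | x⁻¹ , xx⁻¹≡1 = inj₂ (begin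
    y               ≡⟨ sym (*-identityˡ y) ⟩
    1# * y          ≡⟨ cong (_* y) (trans (sym xx⁻¹≡1) (*-comm x x⁻¹)) ⟩
    (x⁻¹ * x) * y   ≡⟨ *-assoc x⁻¹ x y ⟩
    x⁻¹ * (x * y)   ≡⟨ cong (x⁻¹ *_) xy≡0 ⟩
    x⁻¹ * 0#        ≡⟨ zeroʳ x⁻¹ ⟩
    0#              ∎)
    where open ≡-Reasoning

  ^-homo-* : ∀ x i j → x ^ (i ℕ.+ j) ≡ x ^ i * x ^ j
  ^-homo-* x zero    j = sym (*-identityˡ _)
  ^-homo-* x (suc i) j = trans (cong (x *_) (^-homo-* x i j)) (sym (*-assoc x _ _))

  ^-distrib-* : ∀ x y i → (x * y) ^ i ≡ x ^ i * y ^ i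
  ^-distrib-* x y zero    = sym (*-identityˡ 1#)
  ^-distrib-* x y (suc i) =
    trans (cong ((x * y) *_) (^-distrib-* x y i)) (*-interchange x y (x ^ i) (y ^ i))

  ^-assocʳ : ∀ x i j → (x ^ i) ^ j ≡ x ^ (i ℕ.* j)
  ^-assocʳ x zero    j = 1^ j
    where
    1^ : ∀ j → 1# ^ j ≡ 1#
    1^ zero    = refl
    1^ (suc j) = trans (*-identityˡ _) (1^ j)
  ^-assocʳ x (suc i) j =
    trans (^-distrib-* x (x ^ i) j) (trans (cong (x ^ j *_) (^-assocʳ x i j)) (sym (^-homo-* x j (i ℕ.* j))))

  x^n≡0⇒x≡0 : ∀ x n → x ^ n ≡ 0# → x ≡ 0#
  x^n≡0⇒x≡0 x zero    1≡0 = ⊥-elim (0≢1 (sym 1≡0))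
  x^n≡0⇒x≡0 x (suc n) x^n+1≡0 with x*y≡0⇒x≡0⊎y≡0 x (x ^ n) x^n+1≡0
  ... | inj₁ x≡0   = x≡0
  ... | inj₂ x^n≡0 = x^n≡0⇒x≡0 x n x^n≡0

  +-shift-↭ : ∀ c → map (_+ c) elems ↭ elems
  +-shift-↭ c = map-inverse-↭ elems elems-unique (_+ c) (_+ - c) (cancel c (- c) (-‿inverseʳ c))
    (cancel (- c) c (-‿inverseˡ c)) (λ _ → elems-complete _) (λ _ → elems-complete _)
    where
    cancel : ∀ c c′ → c + c′ ≡ 0# → ∀ x → (x + c) + c′ ≡ x
    cancel c c′ c+c′≡0 x = trans (+-assoc x c c′) (trans (cong (x +_) c+c′≡0) (+-identityʳ x))

  -- Shifting the enumeration by 1 adds N · 1 to its sum, so (1 + 1)^(2m) = N · 1 = 0.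
  1+1≡0 : 1# + 1# ≡ 0#
  1+1≡0 = trans (cong (1# +_) (sym (+-identityʳ 1#))) (x^n≡0⇒x≡0 (2 · 1#) (2 ℕ.* m) (begin
    (2 · 1#) ^ (2 ℕ.* m)     ≡⟨ sym (·1-^ 2 (2 ℕ.* m)) ⟩
    (2 ℕ.^ (2 ℕ.* m)) · 1#   ≡⟨ cong (_· 1#) (trans (sym (4^≡2^2* m)) (sym card)) ⟩
    N · 1#                   ≡⟨ identityʳ-unique (∑ᶠ elems) (N · 1#) (trans (sym (∑ᶠ-+1 elems)) ∑ᶠ-shift) ⟩
    0#                       ∎))
    where
    open ≡-Reasoning
    ·1-^ : ∀ a k → (a ℕ.^ k) · 1# ≡ (a · 1#) ^ k
    ·1-^ a zero    = +-identityʳ 1#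
    ·1-^ a (suc k) = trans (×1-homo-* a (a ℕ.^ k)) (cong ((a · 1#) *_) (·1-^ a k))
    ∑ᶠ-+1 : ∀ xs → ∑ᶠ (map (_+ 1#) xs) ≡ ∑ᶠ xs + length xs · 1#
    ∑ᶠ-+1 []       = sym (+-identityˡ 0#)
    ∑ᶠ-+1 (x ∷ xs) = trans (cong ((x + 1#) +_) (∑ᶠ-+1 xs)) (+-interchange x 1# (∑ᶠ xs) (length xs · 1#))
    ∑ᶠ-shift : ∑ᶠ (map (_+ 1#) elems) ≡ ∑ᶠ elems
    ∑ᶠ-shift = ↭ₛ.foldr-commMonoid (setoid Carrier) +-isCommutativeMonoid (↭⇒↭ₛ (+-shift-↭ 1#))

  2+·1 : ∀ k → suc (suc k) · 1# ≡ k · 1#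
  2+·1 k = trans (sym (+-assoc 1# 1# (k · 1#))) (trans (cong (_+ k · 1#) 1+1≡0) (+-identityˡ _))

  ≡-mod-2? : ∀ i j → Maybe (i · 1# ≡ j · 1#)
  ≡-mod-2? zero          zero          = just refl
  ≡-mod-2? (suc zero)    (suc zero)    = just refl
  ≡-mod-2? (suc (suc i)) j             = Maybe.map (trans (2+·1 i)) (≡-mod-2? i j)
  ≡-mod-2? i             (suc (suc j)) = Maybe.map (λ p → trans p (sym (2+·1 j))) (≡-mod-2? i j)
  ≡-mod-2? _             _             = nothing

  -- A ring solver whose constants are compared modulo 2.
  module Char2 = NaturalCoefficients commutativeSemiring ≡-mod-2?
  open Char2 using (solve; _:=_; _:+_; _:*_; _:^_; con)

  x+x≡0 : ∀ x → x + x ≡ 0#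
  x+x≡0 = solve 1 (λ x → x :+ x := con 0) refl

  -x≡x : ∀ x → - x ≡ x
  -x≡x x = sym (inverseʳ-unique x x (x+x≡0 x))

  x+y+y≡x : ∀ x y → (x + y) + y ≡ x
  x+y+y≡x = solve 2 (λ x y → (x :+ y) :+ y := x) refl

  x^2^[1+i]≡[x^2^i]² : ∀ x i → x ^ (2 ℕ.^ suc i) ≡ x ^ (2 ℕ.^ i) * x ^ (2 ℕ.^ i)
  x^2^[1+i]≡[x^2^i]² x i =
    trans (cong (x ^_) (cong (2 ℕ.^ i ℕ.+_) (ℕP.+-identityʳ (2 ℕ.^ i)))) (^-homo-* x (2 ℕ.^ i) (2 ℕ.^ i))

  x^2^[1+i]≡[x²]^2^i : ∀ x i → x ^ (2 ℕ.^ suc i) ≡ (x * x) ^ (2 ℕ.^ i)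
  x^2^[1+i]≡[x²]^2^i x i = trans (x^2^[1+i]≡[x^2^i]² x i) (sym (^-distrib-* x x (2 ℕ.^ i)))

  frobenius : ∀ i x y → (x + y) ^ (2 ℕ.^ i) ≡ x ^ (2 ℕ.^ i) + y ^ (2 ℕ.^ i)
  frobenius zero    x y = solve 2 (λ x y → (x :+ y) :^ 1 := x :^ 1 :+ y :^ 1) refl x y
  frobenius (suc i) x y = begin
    (x + y) ^ (2 ℕ.^ suc i)                       ≡⟨ x^2^[1+i]≡[x²]^2^i (x + y) i ⟩
    ((x + y) * (x + y)) ^ (2 ℕ.^ i)               ≡⟨ cong (_^ 2 ℕ.^ i) (solve 2 (λ x y → (x :+ y) :* (x :+ y) := x :* x :+ y :* y) refl x y) ⟩
    (x * x + y * y) ^ (2 ℕ.^ i)                   ≡⟨ frobenius i (x * x) (y * y) ⟩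
    (x * x) ^ (2 ℕ.^ i) + (y * y) ^ (2 ℕ.^ i)     ≡⟨ sym (cong₂ _+_ (x^2^[1+i]≡[x²]^2^i x i) (x^2^[1+i]≡[x²]^2^i y i)) ⟩
    x ^ (2 ℕ.^ suc i) + y ^ (2 ℕ.^ suc i)         ∎
    where open ≡-Reasoning

  -- Fermat: multiplication by x ≠ 0 permutes the nonzero elements.
  nonzeros : List Carrier
  nonzeros = filterᵇ (not ∘ isZero) elems

  ∈-nonzeros : ∀ {y} → y ≢ 0# → y ∈ nonzeros
  ∈-nonzeros y≢0 = ∈-filter⁺ (T? ∘ not ∘ isZero) (elems-complete _) (fromWitnessFalse y≢0)

  nonzeros-≢0 : ∀ {y} → y ∈ nonzeros → y ≢ 0#
  nonzeros-≢0 y∈ = toWitnessFalse (proj₂ (∈-filter⁻ (T? ∘ not ∘ isZero) {xs = elems} y∈))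

  N≡1+|nonzeros| : N ≡ suc (length nonzeros)
  N≡1+|nonzeros| = sym (trans (cong (ℕ._+ length nonzeros) (sym (count-≟ _≟_ elems-unique (elems-complete 0#))))
    (count-split isZero elems))

  ∏ᶠ-*ˡ : ∀ x ys → ∏ᶠ (map (x *_) ys) ≡ x ^ length ys * ∏ᶠ ys
  ∏ᶠ-*ˡ x []       = sym (*-identityˡ 1#)
  ∏ᶠ-*ˡ x (y ∷ ys) = trans (cong ((x * y) *_) (∏ᶠ-*ˡ x ys)) (*-interchange x y _ _)

  ∏ᶠ-≢0 : ∀ ys → (∀ {y} → y ∈ ys → y ≢ 0#) → ∏ᶠ ys ≢ 0#
  ∏ᶠ-≢0 []       _    1≡0 = 0≢1 (sym 1≡0)
  ∏ᶠ-≢0 (y ∷ ys) ys≢0 ∏≡0 with x*y≡0⇒x≡0⊎y≡0 y (∏ᶠ ys) ∏≡0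
  ... | inj₁ y≡0 = ys≢0 (here refl) y≡0
  ... | inj₂ ∏≡0 = ∏ᶠ-≢0 ys (ys≢0 ∘ there) ∏≡0

  x*y≡y⇒x≡1 : ∀ x y → y ≢ 0# → x * y ≡ y → x ≡ 1#
  x*y≡y⇒x≡1 x y y≢0 xy≡y with inverse y y≢0
  ... | y⁻¹ , yy⁻¹≡1 = begin
    x                ≡⟨ sym (*-identityʳ x) ⟩
    x * 1#           ≡⟨ cong (x *_) (sym yy⁻¹≡1) ⟩
    x * (y * y⁻¹)    ≡⟨ sym (*-assoc x y y⁻¹) ⟩
    (x * y) * y⁻¹    ≡⟨ cong (_* y⁻¹) xy≡y ⟩
    y * y⁻¹          ≡⟨ yy⁻¹≡1 ⟩
    1#               ∎
    where open ≡-Reasoning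

  x^|nonzeros|≡1 : ∀ x → x ≢ 0# → x ^ length nonzeros ≡ 1#
  x^|nonzeros|≡1 x x≢0 with inverse x x≢0
  ... | x⁻¹ , xx⁻¹≡1 = x*y≡y⇒x≡1 _ _ (∏ᶠ-≢0 nonzeros nonzeros-≢0)
    (trans (sym (∏ᶠ-*ˡ x nonzeros)) (↭ₛ.foldr-commMonoid (setoid Carrier) *-isCommutativeMonoid (↭⇒↭ₛ x*-↭)))
    where
    x⁻¹≢0 : x⁻¹ ≢ 0#
    x⁻¹≢0 x⁻¹≡0 = 0≢1 (trans (sym (zeroʳ x)) (trans (cong (x *_) (sym x⁻¹≡0)) xx⁻¹≡1))
    cancel : ∀ u v → u * v ≡ 1# → ∀ y → u * (v * y) ≡ y
    cancel u v uv≡1 y = trans (sym (*-assoc u v y)) (trans (cong (_* y) uv≡1) (*-identityˡ y))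
    *-≢0 : ∀ {u y} → u ≢ 0# → y ≢ 0# → u * y ≢ 0#
    *-≢0 u≢0 y≢0 uy≡0 = [ u≢0 , y≢0 ]′ (x*y≡0⇒x≡0⊎y≡0 _ _ uy≡0)
    x*-↭ : map (x *_) nonzeros ↭ nonzeros
    x*-↭ = map-inverse-↭ nonzeros (Unique.filter⁺ (T? ∘ not ∘ isZero) elems-unique) (x *_) (x⁻¹ *_)
      (cancel x⁻¹ x (trans (*-comm x⁻¹ x) xx⁻¹≡1)) (cancel x x⁻¹ xx⁻¹≡1)
      (λ y∈ → ∈-nonzeros (*-≢0 x≢0 (nonzeros-≢0 y∈))) (λ y∈ → ∈-nonzeros (*-≢0 x⁻¹≢0 (nonzeros-≢0 y∈)))

  x^N≡x : ∀ x → x ^ N ≡ x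
  x^N≡x x rewrite N≡1+|nonzeros| with x ≟ 0#
  ... | yes refl = zeroˡ _
  ... | no x≢0   = trans (cong (x *_) (x^|nonzeros|≡1 x x≢0)) (*-identityʳ x)

  N≡2^2m : N ≡ 2 ℕ.^ (2 ℕ.* m)
  N≡2^2m = trans card (4^≡2^2* m)

  x^2^2m≡x : ∀ x → x ^ (2 ℕ.^ (2 ℕ.* m)) ≡ x
  x^2^2m≡x x = trans (cong (x ^_) (sym N≡2^2m)) (x^N≡x x)

  Is𝔽₂ : Carrier → Set
  Is𝔽₂ t = t ≡ 0# ⊎ t ≡ 1#

  idempotent⇒𝔽₂ : ∀ t → t * t ≡ t → Is𝔽₂ t
  idempotent⇒𝔽₂ t tt≡t with x*y≡0⇒x≡0⊎y≡0 t (t + 1#)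
         (trans (solve 1 (λ t → t :* (t :+ con 1) := t :* t :+ t) refl t) (trans (cong (_+ t) tt≡t) (x+x≡0 t)))
  ... | inj₁ t≡0   = inj₁ t≡0
  ... | inj₂ t+1≡0 = inj₂ (trans (sym (x+y+y≡x t 1#)) (trans (cong (_+ 1#) t+1≡0) (+-identityˡ 1#)))

  partialTrace : ℕ → Carrier → Carrier
  partialTrace zero    x = 0#
  partialTrace (suc n) x = x + partialTrace n (x * x)

  Tr≡partialTrace : ∀ x → Tr x ≡ partialTrace (2 ℕ.* m) x
  Tr≡partialTrace x = trans (∑ᶠ-powers (2 ℕ.* m) 0 (λ i → i) (λ _ → refl)) (cong (partialTrace (2 ℕ.* m)) (*-identityʳ x))
    where
    ∑ᶠ-powers : ∀ n k (g : ℕ → ℕ) → (∀ i → g i ≡ k ℕ.+ i) →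
      ∑ᶠ (map (λ i → x ^ (2 ℕ.^ i)) (applyUpTo g n)) ≡ partialTrace n (x ^ (2 ℕ.^ k))
    ∑ᶠ-powers zero    k g g≗k+ = refl
    ∑ᶠ-powers (suc n) k g g≗k+ =
      cong₂ _+_ (cong (λ e → x ^ (2 ℕ.^ e)) (trans (g≗k+ 0) (ℕP.+-identityʳ k)))
        (trans (∑ᶠ-powers n (suc k) (g ∘ suc) (λ i → trans (g≗k+ (suc i)) (ℕP.+-suc k i)))
          (cong (partialTrace n) (x^2^[1+i]≡[x^2^i]² x k)))

  partialTrace-+ : ∀ n x y → partialTrace n (x + y) ≡ partialTrace n x + partialTrace n y
  partialTrace-+ zero    x y = sym (+-identityˡ 0#)
  partialTrace-+ (suc n) x y = begin
    (x + y) + partialTrace n ((x + y) * (x + y))          ≡⟨ cong (λ z → (x + y) + partialTrace n z) (solve 2 (λ x y → (x :+ y) :* (x :+ y) := x :* x :+ y :* y) refl x y) ⟩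
    (x + y) + partialTrace n (x * x + y * y)              ≡⟨ cong ((x + y) +_) (partialTrace-+ n (x * x) (y * y)) ⟩
    (x + y) + (partialTrace n (x * x) + partialTrace n (y * y)) ≡⟨ +-interchange x y _ _ ⟩
    (x + partialTrace n (x * x)) + (y + partialTrace n (y * y)) ∎
    where open ≡-Reasoning

  partialTrace-² : ∀ n x → partialTrace n x * partialTrace n x ≡ partialTrace n (x * x)
  partialTrace-² zero    x = zeroˡ 0#
  partialTrace-² (suc n) x = trans (solve 2 (λ x t → (x :+ t) :* (x :+ t) := x :* x :+ t :* t) refl x _)
    (cong (x * x +_) (partialTrace-² n (x * x)))

  partialTrace-shift : ∀ n x → partialTrace n (x * x) + x ≡ partialTrace n x + x ^ (2 ℕ.^ n)
  partialTrace-shift zero    x = cong (0# +_) (sym (*-identityʳ x))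
  partialTrace-shift (suc n) x = begin
    (x * x + t) + x                                   ≡⟨ solve 3 (λ s t x → (s :+ t) :+ x := (t :+ s) :+ x) refl (x * x) t x ⟩
    (t + x * x) + x                                   ≡⟨ cong (_+ x) (partialTrace-shift n (x * x)) ⟩
    (partialTrace n (x * x) + (x * x) ^ (2 ℕ.^ n)) + x ≡⟨ solve 3 (λ p y x → (p :+ y) :+ x := (x :+ p) :+ y) refl _ _ x ⟩
    (x + partialTrace n (x * x)) + (x * x) ^ (2 ℕ.^ n) ≡⟨ cong ((x + partialTrace n (x * x)) +_) (sym (x^2^[1+i]≡[x²]^2^i x n)) ⟩
    (x + partialTrace n (x * x)) + x ^ (2 ℕ.^ suc n)   ∎
    where
    open ≡-Reasoning
    t : Carrier
    t = partialTrace n ((x * x) * (x * x))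

  partialTrace-split : ∀ i j x → partialTrace (i ℕ.+ j) x ≡ partialTrace i x + partialTrace j (x ^ (2 ℕ.^ i))
  partialTrace-split zero    j x = trans (cong (partialTrace j) (sym (*-identityʳ x))) (sym (+-identityˡ _))
  partialTrace-split (suc i) j x = trans
    (cong (x +_) (trans (partialTrace-split i j (x * x)) (cong (λ z → partialTrace i (x * x) + partialTrace j z) (sym (x^2^[1+i]≡[x²]^2^i x i)))))
    (sym (+-assoc x _ _))

  Tr-+ : ∀ x y → Tr (x + y) ≡ Tr x + Tr y
  Tr-+ x y = begin
    Tr (x + y)                                            ≡⟨ Tr≡partialTrace (x + y) ⟩
    partialTrace (2 ℕ.* m) (x + y)                        ≡⟨ partialTrace-+ (2 ℕ.* m) x y ⟩
    partialTrace (2 ℕ.* m) x + partialTrace (2 ℕ.* m) y   ≡⟨ sym (cong₂ _+_ (Tr≡partialTrace x) (Tr≡partialTrace y)) ⟩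
    Tr x + Tr y                                           ∎
    where open ≡-Reasoning

  Tr-0 : Tr 0# ≡ 0#
  Tr-0 = identityʳ-unique (Tr 0#) (Tr 0#) (sym (trans (cong Tr (sym (+-identityʳ 0#))) (Tr-+ 0# 0#)))

  Tr-² : ∀ x → Tr (x * x) ≡ Tr x
  Tr-² x = begin
    Tr (x * x)                        ≡⟨ Tr≡partialTrace (x * x) ⟩
    partialTrace 2m (x * x)           ≡⟨ sym (x+y+y≡x _ x) ⟩
    partialTrace 2m (x * x) + x + x   ≡⟨ cong (_+ x) (partialTrace-shift 2m x) ⟩
    partialTrace 2m x + x ^ (2 ℕ.^ 2m) + x ≡⟨ cong (λ z → partialTrace 2m x + z + x) (x^2^2m≡x x) ⟩
    partialTrace 2m x + x + x         ≡⟨ x+y+y≡x _ x ⟩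
    partialTrace 2m x                 ≡⟨ sym (Tr≡partialTrace x) ⟩
    Tr x                              ∎
    where
    open ≡-Reasoning
    2m : ℕ
    2m = 2 ℕ.* m

  Tr-^2^ : ∀ j x → Tr (x ^ (2 ℕ.^ j)) ≡ Tr x
  Tr-^2^ zero    x = cong Tr (*-identityʳ x)
  Tr-^2^ (suc j) x = trans (cong Tr (x^2^[1+i]≡[x^2^i]² x j)) (trans (Tr-² _) (Tr-^2^ j x))

  Tr∈𝔽₂ : ∀ x → Is𝔽₂ (Tr x)
  Tr∈𝔽₂ x = idempotent⇒𝔽₂ (Tr x) (begin
    Tr x * Tr x                                           ≡⟨ cong₂ _*_ (Tr≡partialTrace x) (Tr≡partialTrace x) ⟩
    partialTrace (2 ℕ.* m) x * partialTrace (2 ℕ.* m) x   ≡⟨ partialTrace-² (2 ℕ.* m) x ⟩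
    partialTrace (2 ℕ.* m) (x * x)                        ≡⟨ sym (Tr≡partialTrace (x * x)) ⟩
    Tr (x * x)                                            ≡⟨ Tr-² x ⟩
    Tr x                                                  ∎)
    where open ≡-Reasoning

  _∈k : Carrier → Set
  t ∈k = t ^ q ≡ t

  -- On k the trace is Tr_{k/𝔽₂} taken twice.
  Tr-k≡0 : ∀ {c} → c ∈k → Tr c ≡ 0#
  Tr-k≡0 {c} c^q≡c = begin
    Tr c                                      ≡⟨ Tr≡partialTrace c ⟩
    partialTrace (m ℕ.+ (m ℕ.+ 0)) c          ≡⟨ cong (λ n → partialTrace (m ℕ.+ n) c) (ℕP.+-identityʳ m) ⟩
    partialTrace (m ℕ.+ m) c                  ≡⟨ partialTrace-split m m c ⟩
    partialTrace m c + partialTrace m (c ^ q) ≡⟨ cong (λ z → partialTrace m c + partialTrace m z) c^q≡c ⟩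
    partialTrace m c + partialTrace m c       ≡⟨ x+x≡0 _ ⟩
    0#                                        ∎
    where open ≡-Reasoning

  -- Polynomials as coefficient vectors, lowest degree first.
  eval : ∀ {n} → Vec Carrier n → Carrier → Carrier
  eval []       x = 0#
  eval (c ∷ cs) x = c + x * eval cs x

  divide : ∀ {d} → Vec Carrier (suc d) → Carrier → Vec Carrier d × Carrier
  divide (c ∷ [])       r = [] , c
  divide (c ∷ c′ ∷ cs)  r with divide (c′ ∷ cs) r
  ... | quot , rem = rem ∷ quot , c + r * rem

  eval-divide : ∀ {d} (p : Vec Carrier (suc d)) r x →
    eval p x ≡ (x + r) * eval (proj₁ (divide p r)) x + proj₂ (divide p r)
  eval-divide (c ∷ [])      r x = solve 3 (λ c r x → c :+ x :* con 0 := (x :+ r) :* con 0 :+ c) refl c r x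
  eval-divide (c ∷ c′ ∷ cs) r x with divide (c′ ∷ cs) r | eval-divide (c′ ∷ cs) r x
  ... | quot , rem | ih = trans (cong (λ z → c + x * z) ih)
    (solve 5 (λ c x r Q R → c :+ x :* ((x :+ r) :* Q :+ R) := (x :+ r) :* (R :+ x :* Q) :+ (c :+ r :* R))
      refl c x r (eval quot x) rem)

  IsZeroPoly : ∀ {n} → Vec Carrier n → Set
  IsZeroPoly = VecAll.All (_≡ 0#)

  divide-zero : ∀ {d} (p : Vec Carrier (suc d)) r →
    IsZeroPoly (proj₁ (divide p r)) → proj₂ (divide p r) ≡ 0# → IsZeroPoly p
  divide-zero (c ∷ [])      r _ c≡0 = c≡0 ∷ []
  divide-zero (c ∷ c′ ∷ cs) r with divide (c′ ∷ cs) r | divide-zero (c′ ∷ cs) r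
  ... | quot , rem | ih = λ { (rem≡0 ∷ quot≡0) c+r*rem≡0 →
    trans (sym (trans (cong (λ z → c + r * z) rem≡0) (trans (cong (c +_) (zeroʳ r)) (+-identityʳ c)))) c+r*rem≡0
    ∷ ih quot≡0 rem≡0 }

  roots-bound : ∀ d (p : Vec Carrier (suc d)) (rs : List Carrier) → Unique rs →
    (∀ {r} → r ∈ rs → eval p r ≡ 0#) → suc d ≤ length rs → IsZeroPoly p
  roots-bound zero    (c ∷ []) (r ∷ rs) _ roots _ =
    trans (sym (trans (cong (c +_) (zeroʳ r)) (+-identityʳ c))) (roots (here refl)) ∷ []
  roots-bound (suc d) p (r ∷ rs) (r∉rs AllPairs.∷ rs!) roots (s≤s d<|rs|) =
    divide-zero p r (roots-bound d quot rs rs! quot-roots d<|rs|) rem≡0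
    where
    quot : Vec Carrier (suc d)
    quot = proj₁ (divide p r)
    rem : Carrier
    rem  = proj₂ (divide p r)
    rem≡0 : rem ≡ 0#
    rem≡0 = trans (sym (begin
      eval p r                     ≡⟨ eval-divide p r r ⟩
      (r + r) * eval quot r + rem  ≡⟨ cong (λ z → z * eval quot r + rem) (x+x≡0 r) ⟩
      0# * eval quot r + rem       ≡⟨ cong (_+ rem) (zeroˡ _) ⟩
      0# + rem                     ≡⟨ +-identityˡ rem ⟩
      rem                          ∎)) (roots (here refl))
      where open ≡-Reasoning
    quot-roots : ∀ {r′} → r′ ∈ rs → eval quot r′ ≡ 0#
    quot-roots {r′} r′∈rs with x*y≡0⇒x≡0⊎y≡0 (r′ + r) (eval quot r′)
      (trans (sym (trans (cong ((r′ + r) * eval quot r′ +_) rem≡0) (+-identityʳ _)))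
        (trans (sym (eval-divide p r r′)) (roots (there r′∈rs))))
    ... | inj₁ r′+r≡0 = ⊥-elim (All.lookup r∉rs r′∈rs
      (sym (trans (sym (x+y+y≡x r′ r)) (trans (cong (_+ r) r′+r≡0) (+-identityˡ r)))))
    ... | inj₂ q≡0 = q≡0

  monomial : ∀ L → ℕ → Vec Carrier L
  monomial zero    e       = []
  monomial (suc L) zero    = 1# ∷ Vec.replicate L 0#
  monomial (suc L) (suc e) = 0# ∷ monomial L e

  eval-replicate-0 : ∀ L x → eval (Vec.replicate L 0#) x ≡ 0#
  eval-replicate-0 zero    x = refl
  eval-replicate-0 (suc L) x = trans (+-identityˡ _) (trans (cong (x *_) (eval-replicate-0 L x)) (zeroʳ x))

  eval-monomial : ∀ L e x → e < L → eval (monomial L e) x ≡ x ^ e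
  eval-monomial (suc L) zero    x _ =
    trans (cong (1# +_) (trans (cong (x *_) (eval-replicate-0 L x)) (zeroʳ x))) (+-identityʳ 1#)
  eval-monomial (suc L) (suc e) x (s≤s e<L) = trans (+-identityˡ _) (cong (x *_) (eval-monomial L e x e<L))

  eval-+ : ∀ {L} (p p′ : Vec Carrier L) x → eval (Vec.zipWith _+_ p p′) x ≡ eval p x + eval p′ x
  eval-+ []      []        x = sym (+-identityˡ 0#)
  eval-+ (c ∷ p) (c′ ∷ p′) x = trans (cong (λ z → (c + c′) + x * z) (eval-+ p p′ x))
    (solve 5 (λ c c′ x v v′ → (c :+ c′) :+ x :* (v :+ v′) := (c :+ x :* v) :+ (c′ :+ x :* v′)) refl c c′ x _ _)

  tracePoly : ∀ L → ℕ → Vec Carrier L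
  tracePoly L zero    = Vec.replicate L 0#
  tracePoly L (suc n) = Vec.zipWith _+_ (tracePoly L n) (monomial L (2 ℕ.^ n))

  eval-tracePoly : ∀ L n x → 2 ℕ.^ n ≤ L → eval (tracePoly L n) x ≡ partialTrace n x
  eval-tracePoly L zero    x _ = eval-replicate-0 L x
  eval-tracePoly L (suc n) x 2^[1+n]≤L = begin
    eval (tracePoly L (suc n)) x                               ≡⟨ eval-+ (tracePoly L n) _ x ⟩
    eval (tracePoly L n) x + eval (monomial L (2 ℕ.^ n)) x     ≡⟨ cong₂ _+_ (eval-tracePoly L n x (ℕP.≤-trans (ℕP.^-monoʳ-≤ 2 (ℕP.n≤1+n n)) 2^[1+n]≤L))
                                                                   (eval-monomial L _ x (ℕP.<-≤-trans (ℕP.^-monoʳ-< 2 (s≤s (s≤s z≤n)) (ℕP.n<1+n n)) 2^[1+n]≤L)) ⟩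
    partialTrace n x + x ^ (2 ℕ.^ n)                           ≡⟨ sym (partialTrace-shift n x) ⟩
    partialTrace n (x * x) + x                                 ≡⟨ +-comm _ x ⟩
    partialTrace (suc n) x                                     ∎
    where open ≡-Reasoning

  linear-coefficient : ∀ {D} → Vec Carrier (suc (suc D)) → Carrier
  linear-coefficient (_ ∷ c ∷ _) = c

  linear-coefficient-+ : ∀ {D} (p p′ : Vec Carrier (suc (suc D))) →
    linear-coefficient (Vec.zipWith _+_ p p′) ≡ linear-coefficient p + linear-coefficient p′
  linear-coefficient-+ (_ ∷ _ ∷ _) (_ ∷ _ ∷ _) = refl

  linear-coefficient-monomial : ∀ D e → 2 ≤ e → linear-coefficient (monomial (suc (suc D)) e) ≡ 0#
  linear-coefficient-monomial D (suc (suc e)) _ = refl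
  linear-coefficient-monomial D (suc zero) (s≤s ())

  linear-coefficient-tracePoly : ∀ D n → 1 ≤ n → linear-coefficient (tracePoly (suc (suc D)) n) ≡ 1#
  linear-coefficient-tracePoly D (suc zero)    _ = +-identityˡ 1#
  linear-coefficient-tracePoly D (suc (suc n)) _ = begin
    linear-coefficient (tracePoly L (suc (suc n)))                        ≡⟨ linear-coefficient-+ (tracePoly L (suc n)) _ ⟩
    linear-coefficient (tracePoly L (suc n)) + linear-coefficient (monomial L (2 ℕ.^ suc n))
      ≡⟨ cong₂ _+_ (linear-coefficient-tracePoly D (suc n) (s≤s z≤n))
                   (linear-coefficient-monomial D _ (ℕP.*-monoʳ-≤ 2 (ℕP.m^n>0 2 n))) ⟩
    1# + 0#                                                                ≡⟨ +-identityʳ 1# ⟩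
    1#                                                                     ∎
    where
    open ≡-Reasoning
    L : ℕ
    L = suc (suc D)

  -- Otherwise X + X² + ⋯ + X^(2^(2m-1)), of degree < N, would vanish at all N points.
  Tr-surjective : 1 ≤ m → ∃[ t ] Tr t ≡ 1#
  Tr-surjective 1≤m with any? (λ t → Tr t ≟ 1#) elems
  ... | yes ∃Tr≡1 = satisfied ∃Tr≡1
  ... | no  ∄Tr≡1 with ∈⇒length≡suc (∈-nonzeros {1#} (0≢1 ∘ sym))
  ... | D , |nonzeros|≡1+D = ⊥-elim (0≢1 (sym (begin
    1#                    ≡⟨ sym (linear-coefficient-tracePoly D (2 ℕ.* m) (ℕP.≤-trans 1≤m (ℕP.m≤m+n m _))) ⟩
    linear-coefficient P  ≡⟨ linear-coefficient-zero (roots-bound (suc D) P elems elems-unique P-roots (ℕP.≤-reflexive (sym N≡2+D))) ⟩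
    0#                    ∎)))
    where
    open ≡-Reasoning
    N≡2+D : N ≡ suc (suc D)
    N≡2+D = trans N≡1+|nonzeros| (cong suc |nonzeros|≡1+D)
    P : Vec Carrier (suc (suc D))
    P = tracePoly (suc (suc D)) (2 ℕ.* m)
    linear-coefficient-zero : ∀ {D} {p : Vec Carrier (suc (suc D))} → IsZeroPoly p → linear-coefficient p ≡ 0#
    linear-coefficient-zero (_ ∷ c≡0 ∷ _) = c≡0
    P-roots : ∀ {r} → r ∈ elems → eval P r ≡ 0#
    P-roots {r} r∈ with Tr∈𝔽₂ r
    ... | inj₁ Tr≡0 = trans (eval-tracePoly _ (2 ℕ.* m) r (ℕP.≤-reflexive (trans (sym N≡2^2m) N≡2+D)))
                         (trans (sym (Tr≡partialTrace r)) Tr≡0)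
    ... | inj₂ Tr≡1 = ⊥-elim (∄Tr≡1 (AnyList.map (λ { refl → Tr≡1 }) r∈))

  Tr-nondegenerate : 1 ≤ m → ∀ x → (∀ y → Tr (x * y) ≡ 0#) → x ≡ 0#
  Tr-nondegenerate 1≤m x Tr[x*_]≡0 with x ≟ 0# | Tr-surjective 1≤m
  ... | yes x≡0 | _ = x≡0
  ... | no x≢0  | t , Tr-t≡1 with inverse x x≢0
  ... | x⁻¹ , xx⁻¹≡1 = ⊥-elim (0≢1 (begin
    0#                  ≡⟨ sym (Tr[x*_]≡0 (x⁻¹ * t)) ⟩
    Tr (x * (x⁻¹ * t))  ≡⟨ cong Tr (sym (*-assoc x x⁻¹ t)) ⟩
    Tr ((x * x⁻¹) * t)  ≡⟨ cong (λ z → Tr (z * t)) xx⁻¹≡1 ⟩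
    Tr (1# * t)         ≡⟨ cong Tr (*-identityˡ t) ⟩
    Tr t                ≡⟨ Tr-t≡1 ⟩
    1#                  ∎))
    where open ≡-Reasoning

  -- Characters and double counting

  χ : Carrier → ℤ
  χ t = if isZero t then 1ℤ else -1ℤ

  χ-0 : χ 0# ≡ 1ℤ
  χ-0 with 0# ≟ 0#
  ... | yes _   = refl
  ... | no 0≢0  = ⊥-elim (0≢0 refl)

  χ-1 : χ 1# ≡ -1ℤ
  χ-1 with 1# ≟ 0#
  ... | yes 1≡0 = ⊥-elim (0≢1 (sym 1≡0))
  ... | no _    = refl

  χ-+ : ∀ {s t} → Is𝔽₂ s → Is𝔽₂ t → χ (s + t) ≡ χ s *ℤ χ t
  χ-+ (inj₁ refl) (inj₁ refl) = trans (cong χ (+-identityˡ 0#)) (trans χ-0 (sym (cong₂ _*ℤ_ χ-0 χ-0)))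
  χ-+ (inj₁ refl) (inj₂ refl) = trans (cong χ (+-identityˡ 1#)) (trans χ-1 (sym (cong₂ _*ℤ_ χ-0 χ-1)))
  χ-+ (inj₂ refl) (inj₁ refl) = trans (cong χ (+-identityʳ 1#)) (trans χ-1 (sym (cong₂ _*ℤ_ χ-1 χ-0)))
  χ-+ (inj₂ refl) (inj₂ refl) = trans (cong χ 1+1≡0) (trans χ-0 (sym (cong₂ _*ℤ_ χ-1 χ-1)))

  𝟙*χ≡2𝟙-𝟙 : ∀ u t → 𝟙 u *ℤ χ t ≡ pos 2 *ℤ 𝟙 (u ∧ isZero t) +ℤ -ℤ 𝟙 u
  𝟙*χ≡2𝟙-𝟙 true  t with isZero t
  ... | true  = refl
  ... | false = refl
  𝟙*χ≡2𝟙-𝟙 false t = refl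

  ∑F : (Carrier → ℤ) → ℤ
  ∑F = ∑ elems

  ∑F-shift : ∀ c f → ∑F f ≡ ∑F (λ x → f (x + c))
  ∑F-shift c f = trans (sym (∑-↭ f (+-shift-↭ c))) (∑-map elems (_+ c) f)

  ∑F-𝟙 : ∀ p → ∑F (𝟙 ∘ p) ≡ pos (count p)
  ∑F-𝟙 = ∑-𝟙 elems

  record IsSubgroup (A : Carrier → Bool) : Set where
    field
      0∈ : T (A 0#)
      +∈ : ∀ {x y} → T (A x) → T (A y) → T (A (x + y))

  vanishesOn : (Carrier → Carrier) → (Carrier → Bool) → Bool
  vanishesOn φ A = all (λ x → not (A x) ∨ isZero (φ x)) elems

  vanishesOn⇒ : ∀ {φ A} → T (vanishesOn φ A) → ∀ {x} → T (A x) → φ x ≡ 0#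
  vanishesOn⇒ {φ} {A} φ|A≡0 {x} x∈A with A x | All.lookup (all⁺ _ elems φ|A≡0) (elems-complete x)
  ... | true | φx≡0 = toWitness φx≡0

  vanishesOn⇐ : ∀ {φ A} → (∀ {x} → T (A x) → φ x ≡ 0#) → T (vanishesOn φ A)
  vanishesOn⇐ {φ} {A} φ|A≡0 = all⁻ _ (All.universal vanishes-at elems)
    where
    vanishes-at : ∀ x → T (not (A x) ∨ isZero (φ x))
    vanishes-at x with A x in x∈A
    ... | true  = fromWitness (φ|A≡0 (subst T (sym x∈A) _))
    ... | false = _

  ¬vanishesOn⇒ : ∀ {φ A} → ¬ T (vanishesOn φ A) → ∃[ x ] T (A x) × φ x ≢ 0#
  ¬vanishesOn⇒ {φ} {A} φ|A≢0 with satisfied (¬All⇒Any¬ (T? ∘ _) elems (φ|A≢0 ∘ all⁻ _))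
  ... | x , ¬[x∉A∨φx≡0] with A x in x∈A?
  ... | true  = x , subst T (sym x∈A?) _ , ¬[x∉A∨φx≡0] ∘ fromWitness
  ... | false = ⊥-elim (¬[x∉A∨φx≡0] _)

  module _ {A : Carrier → Bool} (A-subgroup : IsSubgroup A) (φ : Carrier → Carrier)
           (φ∈𝔽₂ : ∀ {x} → T (A x) → Is𝔽₂ (φ x))
           (φ-+ : ∀ {x y} → T (A x) → T (A y) → φ (x + y) ≡ φ x + φ y) where
    open IsSubgroup A-subgroup

    -- If φ x₀ = 1 for some x₀ ∈ A, translating by x₀ negates the sum.
    ∑-character : ∑F (λ x → 𝟙 (A x) *ℤ χ (φ x)) ≡ 𝟙 (vanishesOn φ A) *ℤ pos (count A)
    ∑-character with vanishesOn φ A in φ|A≡0?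
    ... | true = trans (∑-cong elems term≡𝟙) (trans (∑F-𝟙 A) (sym (ℤP.*-identityˡ _)))
      where
      term≡𝟙 : ∀ {x} → x ∈ elems → 𝟙 (A x) *ℤ χ (φ x) ≡ 𝟙 (A x)
      term≡𝟙 {x} _ with A x in x∈A
      ... | false = refl
      ... | true  = trans (cong (λ t → 1ℤ *ℤ χ t) (vanishesOn⇒ (subst T (sym φ|A≡0?) _) (subst T (sym x∈A) _)))
                          (cong (1ℤ *ℤ_) χ-0)
    ... | false with ¬vanishesOn⇒ (subst T φ|A≡0?)
    ... | x₀ , x₀∈A , φx₀≢0 = i≡-i⇒i≡0 _ (trans (∑F-shift x₀ g) (trans (∑-cong elems (λ _ → g-flip _)) (∑-neg elems g)))
      where
      g : Carrier → ℤ
      g x = 𝟙 (A x) *ℤ χ (φ x)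
      φx₀≡1 : φ x₀ ≡ 1#
      φx₀≡1 = [ ⊥-elim ∘ φx₀≢0 , (λ φx₀≡1 → φx₀≡1) ]′ (φ∈𝔽₂ x₀∈A)
      g-flip : ∀ x → g (x + x₀) ≡ -ℤ g x
      g-flip x with A x in x∈A?
      ... | true with x∈A ← subst T (sym x∈A?) _ rewrite Equivalence.to T-≡ (+∈ x∈A x₀∈A) = begin
        1ℤ *ℤ χ (φ (x + x₀))       ≡⟨ cong (λ t → 1ℤ *ℤ χ t) (trans (φ-+ x∈A x₀∈A) (cong (φ x +_) φx₀≡1)) ⟩
        1ℤ *ℤ χ (φ x + 1#)         ≡⟨ cong (1ℤ *ℤ_) (trans (χ-+ (φ∈𝔽₂ x∈A) (inj₂ refl)) (cong (χ (φ x) *ℤ_) χ-1)) ⟩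
        1ℤ *ℤ (χ (φ x) *ℤ -1ℤ)     ≡⟨ ℤP.*-identityˡ _ ⟩
        χ (φ x) *ℤ -1ℤ             ≡⟨ ℤP.*-comm (χ (φ x)) -1ℤ ⟩
        -1ℤ *ℤ χ (φ x)             ≡⟨ ℤP.-1*i≡-i (χ (φ x)) ⟩
        -ℤ χ (φ x)                 ≡⟨ cong -ℤ_ (ℤP.*-identityˡ (χ (φ x))) ⟨
        -ℤ (1ℤ *ℤ χ (φ x))         ∎
        where open ≡-Reasoning
      ... | false with A (x + x₀) in x+x₀∈A?
      ... | false = refl
      ... | true with () ← trans (sym x∈A?) (trans (cong A (sym (x+y+y≡x x x₀)))
                                (Equivalence.to T-≡ (+∈ (subst T (sym x+x₀∈A?) _) x₀∈A)))

  everything : IsSubgroup (λ _ → true)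
  everything = record { 0∈ = _ ; +∈ = λ _ _ → _ }

  count-everything : count (λ _ → true) ≡ N
  count-everything = count-true elems

  module _ {A : Carrier → Bool} (A-subgroup : IsSubgroup A) (B : Carrier → Carrier → Carrier)
           (B∈𝔽₂ : ∀ a y → Is𝔽₂ (B a y))
           (B-+ˡ : ∀ a a′ y → B (a + a′) y ≡ B a y + B a′ y)
           (B-+ʳ : ∀ a y y′ → B a (y + y′) ≡ B a y + B a y′) where
    open IsSubgroup A-subgroup

    orthogonal radical : Carrier → Bool
    orthogonal y = vanishesOn (λ a → B a y) A
    radical    a = vanishesOn (B a) (λ _ → true)

    -- Evaluate ∑_{a ∈ A} ∑_y χ (B a y) in both orders.
    count-orthogonal : count A ℕ.* count orthogonal ≡ N ℕ.* count (λ a → A a ∧ radical a)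
    count-orthogonal = ℤP.+-injective (begin
      pos (count A ℕ.* count orthogonal)                             ≡⟨ ℤP.pos-* (count A) _ ⟩
      pos (count A) *ℤ pos (count orthogonal)                         ≡⟨ cong (pos (count A) *ℤ_) (∑F-𝟙 orthogonal) ⟨
      pos (count A) *ℤ ∑F (𝟙 ∘ orthogonal)                            ≡⟨ ∑-*ˡ elems (pos (count A)) _ ⟨
      ∑F (λ y → pos (count A) *ℤ 𝟙 (orthogonal y))                    ≡⟨ ∑-cong elems (λ {y} _ → trans (ℤP.*-comm (pos (count A)) (𝟙 (orthogonal y)))
                                                                           (sym (∑-character A-subgroup (λ a → B a y) (λ _ → B∈𝔽₂ _ y) (λ _ _ → B-+ˡ _ _ y)))) ⟩
      ∑F (λ y → ∑F (λ a → 𝟙 (A a) *ℤ χ (B a y)))                      ≡⟨ ∑-comm elems elems _ ⟨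
      ∑F (λ a → ∑F (λ y → 𝟙 (A a) *ℤ χ (B a y)))                      ≡⟨ ∑-cong elems (λ {a} _ → trans (∑-*ˡ elems (𝟙 (A a)) _)
                                                                           (cong (𝟙 (A a) *ℤ_) (full-sum a))) ⟩
      ∑F (λ a → 𝟙 (A a) *ℤ (𝟙 (radical a) *ℤ pos N))                 ≡⟨ ∑-cong elems (λ {a} _ → regroup (𝟙 (A a)) (𝟙 (radical a)) (pos N)) ⟩
      ∑F (λ a → pos N *ℤ (𝟙 (A a) *ℤ 𝟙 (radical a)))                 ≡⟨ ∑-cong elems (λ {a} _ → cong (pos N *ℤ_) (𝟙-∧ (A a) (radical a))) ⟨
      ∑F (λ a → pos N *ℤ 𝟙 (A a ∧ radical a))                         ≡⟨ ∑-*ˡ elems (pos N) _ ⟩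
      pos N *ℤ ∑F (λ a → 𝟙 (A a ∧ radical a))                         ≡⟨ cong (pos N *ℤ_) (∑F-𝟙 _) ⟩
      pos N *ℤ pos (count (λ a → A a ∧ radical a))                    ≡⟨ ℤP.pos-* N _ ⟨
      pos (N ℕ.* count (λ a → A a ∧ radical a))                       ∎)
      where
      open ≡-Reasoning
      regroup : ∀ i j k → i *ℤ (j *ℤ k) ≡ k *ℤ (i *ℤ j)
      regroup = ℤ-Solver.solve-∀
      full-sum : ∀ a → ∑F (λ y → χ (B a y)) ≡ 𝟙 (radical a) *ℤ pos N
      full-sum a = trans (∑-cong elems (λ _ → sym (ℤP.*-identityˡ _)))
        (trans (∑-character everything (B a) (λ _ → B∈𝔽₂ a _) (λ _ _ → B-+ʳ a _ _))
          (cong (λ n → 𝟙 (radical a) *ℤ pos n) count-everything))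

  module _ (1≤m : 1 ≤ m) {A : Carrier → Bool} (A-subgroup : IsSubgroup A) where
    open IsSubgroup A-subgroup

    -- The trace pairing (a, y) ↦ Tr (a y) has radical 0, so |A| · |A^⊥| = N.
    subgroup-count-∣ : count A ∣ N
    subgroup-count-∣ = divides (count orthogonal′) (begin
      N                                            ≡⟨ ℕP.*-identityʳ N ⟨
      N ℕ.* 1                                      ≡⟨ cong (N ℕ.*_) radical-count ⟨
      N ℕ.* count (λ a → A a ∧ radical′ a)         ≡⟨ count-orthogonal A-subgroup trace-pairing Tr∈𝔽₂′ Tr-+ˡ Tr-+ʳ ⟨
      count A ℕ.* count orthogonal′                ≡⟨ ℕP.*-comm (count A) _ ⟩
      count orthogonal′ ℕ.* count A                ∎)
      where
      open ≡-Reasoning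
      trace-pairing : Carrier → Carrier → Carrier
      trace-pairing a y = Tr (a * y)
      Tr∈𝔽₂′ : ∀ a y → Is𝔽₂ (trace-pairing a y)
      Tr∈𝔽₂′ a y = Tr∈𝔽₂ (a * y)
      Tr-+ˡ : ∀ a a′ y → trace-pairing (a + a′) y ≡ trace-pairing a y + trace-pairing a′ y
      Tr-+ˡ a a′ y = trans (cong Tr (distribʳ y a a′)) (Tr-+ _ _)
      Tr-+ʳ : ∀ a y y′ → trace-pairing a (y + y′) ≡ trace-pairing a y + trace-pairing a y′
      Tr-+ʳ a y y′ = trans (cong Tr (distribˡ a y y′)) (Tr-+ _ _)
      orthogonal′ radical′ : Carrier → Bool
      orthogonal′ = orthogonal A-subgroup trace-pairing Tr∈𝔽₂′ Tr-+ˡ Tr-+ʳ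
      radical′ = radical A-subgroup trace-pairing Tr∈𝔽₂′ Tr-+ˡ Tr-+ʳ
      radical-count : count (λ a → A a ∧ radical′ a) ≡ 1
      radical-count = trans (count-cong _ isZero elems (λ a → mk⇔ to (from a)))
                            (count-≟ _≟_ elems-unique (elems-complete 0#))
        where
        to : ∀ {a} → T (A a ∧ radical′ a) → T (isZero a)
        to a∈A∩rad = fromWitness (Tr-nondegenerate 1≤m _
          (λ y → vanishesOn⇒ (proj₂ (Equivalence.to T-∧ a∈A∩rad)) {y} _))
        from : ∀ a → T (isZero a) → T (A a ∧ radical′ a)
        from a a≡0 with refl ← toWitness {a? = a ≟ 0#} a≡0 =
          Equivalence.from T-∧ (0∈ , vanishesOn⇐ (λ {y} _ → trans (cong Tr (zeroˡ y)) Tr-0))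

    subgroup-count-2^ : ∃[ j ] count A ≡ 2 ℕ.^ j
    subgroup-count-2^ = ∣2^⇒≡2^ (2 ℕ.* m) (count A) (subst (count A ∣_) N≡2^2m subgroup-count-∣)

  ∑-𝟙*χ : ∀ (p : Carrier → Bool) (f : Carrier → Carrier) → ∑F (λ x → 𝟙 (p x) *ℤ χ (f x))
                 ≡ pos 2 *ℤ pos (count (λ x → p x ∧ isZero (f x))) +ℤ -ℤ pos (count p)
  ∑-𝟙*χ p f = begin
    ∑F (λ x → 𝟙 (p x) *ℤ χ (f x))                                           ≡⟨ ∑-cong elems (λ {x} _ → 𝟙*χ≡2𝟙-𝟙 (p x) (f x)) ⟩
    ∑F (λ x → pos 2 *ℤ 𝟙 (p x ∧ isZero (f x)) +ℤ -ℤ 𝟙 (p x))                  ≡⟨ ∑-+ elems _ _ ⟩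
    ∑F (λ x → pos 2 *ℤ 𝟙 (p x ∧ isZero (f x))) +ℤ ∑F (λ x → -ℤ 𝟙 (p x))     ≡⟨ cong₂ _+ℤ_ (∑-*ˡ elems (pos 2) _) (∑-neg elems _) ⟩
    pos 2 *ℤ ∑F (λ x → 𝟙 (p x ∧ isZero (f x))) +ℤ -ℤ ∑F (𝟙 ∘ p)             ≡⟨ cong₂ (λ i j → pos 2 *ℤ i +ℤ -ℤ j) (∑F-𝟙 _) (∑F-𝟙 p) ⟩
    pos 2 *ℤ pos (count (λ x → p x ∧ isZero (f x))) +ℤ -ℤ pos (count p)      ∎
    where open ≡-Reasoning

  +-∈k : ∀ {s t} → s ∈k → t ∈k → (s + t) ∈k
  +-∈k s∈k t∈k = trans (frobenius m _ _) (cong₂ _+_ s∈k t∈k)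

  *-∈k : ∀ {s t} → s ∈k → t ∈k → (s * t) ∈k
  *-∈k s∈k t∈k = trans (^-distrib-* _ _ q) (cong₂ _*_ s∈k t∈k)

  ^-∈k : ∀ {t} n → t ∈k → (t ^ n) ∈k
  ^-∈k {t} n t∈k = begin
    (t ^ n) ^ q    ≡⟨ ^-assocʳ t n q ⟩
    t ^ (n ℕ.* q)  ≡⟨ cong (t ^_) (ℕP.*-comm n q) ⟩
    t ^ (q ℕ.* n)  ≡⟨ sym (^-assocʳ t q n) ⟩
    (t ^ q) ^ n    ≡⟨ cong (_^ n) t∈k ⟩
    t ^ n          ∎
    where open ≡-Reasoning

  k-subgroup : IsSubgroup inK
  k-subgroup = record
    { 0∈ = fromWitness (identityʳ-unique (0# ^ q) (0# ^ q) (sym (trans (cong (_^ q) (sym (+-identityʳ 0#))) (frobenius m 0# 0#))))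
    ; +∈ = λ s∈k t∈k → fromWitness (+-∈k (toWitness s∈k) (toWitness t∈k))
    }

  ^2^-cancel : ∀ e j → e ℕ.+ j ≡ 2 ℕ.* m → ∀ u → (u ^ (2 ℕ.^ e)) ^ (2 ℕ.^ j) ≡ u
  ^2^-cancel e j e+j≡2m u = trans (^-assocʳ u (2 ℕ.^ e) (2 ℕ.^ j))
    (trans (cong (u ^_) (trans (sym (2^-+ e j)) (cong (2 ℕ.^_) e+j≡2m))) (x^2^2m≡x u))

  Tr-adjoint : ∀ e j → e ℕ.+ j ≡ 2 ℕ.* m → ∀ u y → Tr (u * y ^ (2 ℕ.^ j)) ≡ Tr (u ^ (2 ℕ.^ e) * y)
  Tr-adjoint e j e+j≡2m u y = begin
    Tr (u * y ^ (2 ℕ.^ j))                                    ≡⟨ cong (λ z → Tr (z * y ^ (2 ℕ.^ j))) (^2^-cancel e j e+j≡2m u) ⟨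
    Tr ((u ^ (2 ℕ.^ e)) ^ (2 ℕ.^ j) * y ^ (2 ℕ.^ j))          ≡⟨ cong Tr (^-distrib-* (u ^ (2 ℕ.^ e)) y (2 ℕ.^ j)) ⟨
    Tr ((u ^ (2 ℕ.^ e) * y) ^ (2 ℕ.^ j))                      ≡⟨ Tr-^2^ j _ ⟩
    Tr (u ^ (2 ℕ.^ e) * y)                                    ∎
    where open ≡-Reasoning

  -- The quadratic form Q̃

  module QuadraticForm (1≤m : 1 ≤ m) {a b c : Carrier} (a∈k : a ∈k) (b∈k : b ∈k) (c∈k : c ∈k) where
    open Forms a b c

    R-+ : ∀ x y → R (x + y) ≡ R x + R y
    R-+ x y = trans (cong₂ (λ u v → a * u + b * v + (c ^ 2) * (x + y)) (frobenius 2 x y) (frobenius 1 x y))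
      (solve 7 (λ a b c x y x⁴ y⁴ →
          a :* (x⁴ :+ y⁴) :+ b :* (x :^ 2 :+ y :^ 2) :+ c :^ 2 :* (x :+ y)
          := (a :* x⁴ :+ b :* x :^ 2 :+ c :^ 2 :* x) :+ (a :* y⁴ :+ b :* y :^ 2 :+ c :^ 2 :* y))
        refl a b c x y (x ^ 4) (y ^ 4))

    ⟨⟩-sym : ∀ x y → ⟨ x , y ⟩ ≡ ⟨ y , x ⟩
    ⟨⟩-sym x y = cong Tr (+-comm _ _)

    ⟨⟩-+ʳ : ∀ x y y′ → ⟨ x , y + y′ ⟩ ≡ ⟨ x , y ⟩ + ⟨ x , y′ ⟩
    ⟨⟩-+ʳ x y y′ = trans (cong (λ z → Tr (x * z + (y + y′) * R x)) (R-+ y y′))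
      (trans (cong Tr (solve 6 (λ x y y′ Ry Ry′ Rx →
          x :* (Ry :+ Ry′) :+ (y :+ y′) :* Rx := (x :* Ry :+ y :* Rx) :+ (x :* Ry′ :+ y′ :* Rx))
        refl x y y′ (R y) (R y′) (R x)))
        (Tr-+ _ _))

    ⟨⟩-+ˡ : ∀ x x′ y → ⟨ x + x′ , y ⟩ ≡ ⟨ x , y ⟩ + ⟨ x′ , y ⟩
    ⟨⟩-+ˡ x x′ y = trans (⟨⟩-sym _ _) (trans (⟨⟩-+ʳ y x x′) (cong₂ _+_ (⟨⟩-sym y x) (⟨⟩-sym y x′)))

    ⟨⟩∈𝔽₂ : ∀ x y → Is𝔽₂ ⟨ x , y ⟩
    ⟨⟩∈𝔽₂ x y = Tr∈𝔽₂ _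

    Q̃-polar : ∀ x y → Q̃ (x + y) ≡ Q̃ x + Q̃ y + ⟨ x , y ⟩
    Q̃-polar x y = trans (cong Tr (solve 5 (λ a b c x y →
        a :* (x :+ y) :^ 5 :+ b :* (x :+ y) :^ 3 :+ c :* (x :+ y)
        := (a :* x :^ 5 :+ b :* x :^ 3 :+ c :* x) :+ (a :* y :^ 5 :+ b :* y :^ 3 :+ c :* y)
           :+ (x :* (a :* y :^ 4 :+ b :* y :^ 2 :+ c :^ 2 :* y) :+ y :* (a :* x :^ 4 :+ b :* x :^ 2 :+ c :^ 2 :* x)))
        refl a b c x y))
      (trans (Tr-+ _ _) (cong (_+ ⟨ x , y ⟩) (Tr-+ _ _)))

    E-+ : ∀ x y → E (x + y) ≡ E x + E y
    E-+ x y = trans (cong₃ (λ u v w → (a ^ 4) * u + (b ^ 4) * v + (b ^ 2) * w + a * (x + y))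
                       (frobenius 4 x y) (frobenius 3 x y) (frobenius 1 x y))
      (solve 12 (λ a⁴ b⁴ b² a x¹⁶ y¹⁶ x⁸ y⁸ x² y² x y →
          a⁴ :* (x¹⁶ :+ y¹⁶) :+ b⁴ :* (x⁸ :+ y⁸) :+ b² :* (x² :+ y²) :+ a :* (x :+ y)
          := (a⁴ :* x¹⁶ :+ b⁴ :* x⁸ :+ b² :* x² :+ a :* x) :+ (a⁴ :* y¹⁶ :+ b⁴ :* y⁸ :+ b² :* y² :+ a :* y))
        refl (a ^ 4) (b ^ 4) (b ^ 2) a (x ^ 16) (y ^ 16) (x ^ 8) (y ^ 8) (x ^ 2) (y ^ 2) x y)
      where
      cong₃ : ∀ {X : Set} (f : Carrier → Carrier → Carrier → X) {u u′ v v′ w w′} →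
              u ≡ u′ → v ≡ v′ → w ≡ w′ → f u v w ≡ f u′ v′ w′
      cong₃ f refl refl refl = refl

    E-0 : E 0# ≡ 0#
    E-0 = identityʳ-unique (E 0#) (E 0#) (sym (trans (cong E (sym (+-identityʳ 0#))) (E-+ 0# 0#)))

    -- L is the adjoint of R for the trace pairing, written with exponents 2m-2, 2m-1 that make
    -- Tr (a x y⁴) = Tr ((a x)^(2^(2m-2)) y) and Tr (b x y²) = Tr ((b x)^(2^(2m-1)) y).
    private
      2≤2m : 2 ≤ 2 ℕ.* m
      2≤2m = ℕP.*-monoʳ-≤ 2 1≤m
      e₁ e₂ : ℕ
      e₁ = 2 ℕ.* m ℕ.∸ 1
      e₂ = 2 ℕ.* m ℕ.∸ 2
      e₁+1≡2m : e₁ ℕ.+ 1 ≡ 2 ℕ.* m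
      e₁+1≡2m = ℕP.m∸n+n≡m (ℕP.≤-trans (s≤s z≤n) 2≤2m)
      e₂+2≡2m : e₂ ℕ.+ 2 ≡ 2 ℕ.* m
      e₂+2≡2m = ℕP.m∸n+n≡m 2≤2m

    L : Carrier → Carrier
    L x = ((a * x) ^ (2 ℕ.^ e₂) + (b * x) ^ (2 ℕ.^ e₁)) + (a * x ^ 4 + b * x ^ 2)

    ⟨⟩≡Tr[L*] : ∀ x y → ⟨ x , y ⟩ ≡ Tr (L x * y)
    ⟨⟩≡Tr[L*] x y = begin
      ⟨ x , y ⟩                                                     ≡⟨ cong Tr (solve 9 (λ a b c x y x⁴ x² y⁴ y² →
                     x :* (a :* y⁴ :+ b :* y² :+ c :^ 2 :* y) :+ y :* (a :* x⁴ :+ b :* x² :+ c :^ 2 :* x)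
                     := (a :* x) :* y⁴ :+ ((b :* x) :* y² :+ (a :* x⁴ :+ b :* x²) :* y))
                     refl a b c x y (x ^ 4) (x ^ 2) (y ^ 4) (y ^ 2)) ⟩
      Tr ((a * x) * y ^ 4 + ((b * x) * y ^ 2 + s * y))              ≡⟨ trace-sum3 _ _ _ ⟩
      Tr ((a * x) * y ^ 4) + (Tr ((b * x) * y ^ 2) + Tr (s * y))    ≡⟨ cong₂ (λ u v → u + (v + Tr (s * y)))
                                                                          (Tr-adjoint e₂ 2 e₂+2≡2m (a * x) y)
                                                                          (Tr-adjoint e₁ 1 e₁+1≡2m (b * x) y) ⟩
      Tr (A * y) + (Tr (B * y) + Tr (s * y))                        ≡⟨ sym (trace-sum3 _ _ _) ⟩
      Tr (A * y + (B * y + s * y))                                  ≡⟨ cong Tr (solve 4 (λ A B s y →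
                                                                          A :* y :+ (B :* y :+ s :* y) := ((A :+ B) :+ s) :* y) refl A B s y) ⟩
      Tr (L x * y)                                                  ∎
      where
      open ≡-Reasoning
      s A B : Carrier
      s = a * x ^ 4 + b * x ^ 2
      A = (a * x) ^ (2 ℕ.^ e₂)
      B = (b * x) ^ (2 ℕ.^ e₁)
      trace-sum3 : ∀ u v w → Tr (u + (v + w)) ≡ Tr u + (Tr v + Tr w)
      trace-sum3 u v w = trans (Tr-+ u _) (cong (Tr u +_) (Tr-+ v w))

    L⁴≡E : ∀ x → L x ^ 4 ≡ E x
    L⁴≡E x = begin
      L x ^ 4                                                      ≡⟨ frobenius 2 _ _ ⟩
      (A + B) ^ 4 + s ^ 4                                          ≡⟨ cong₂ _+_ (frobenius 2 A B) (frobenius 2 _ _) ⟩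
      (A ^ 4 + B ^ 4) + ((a * x ^ 4) ^ 4 + (b * x ^ 2) ^ 4)        ≡⟨ cong₂ (λ u v → (u + v) + ((a * x ^ 4) ^ 4 + (b * x ^ 2) ^ 4))
                                                                         (^2^-cancel e₂ 2 e₂+2≡2m (a * x))
                                                                         (trans (x^2^[1+i]≡[x^2^i]² B 1)
                                                                           (cong₂ _*_ (^2^-cancel e₁ 1 e₁+1≡2m (b * x)) (^2^-cancel e₁ 1 e₁+1≡2m (b * x)))) ⟩
      (a * x + (b * x) * (b * x)) + ((a * x ^ 4) ^ 4 + (b * x ^ 2) ^ 4)
                                                                   ≡⟨ cong₂ (λ u v → (a * x + (b * x) * (b * x)) + (u + v))
                                                                         (trans (^-distrib-* a (x ^ 4) 4) (cong (a ^ 4 *_) (^-assocʳ x 4 4)))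
                                                                         (trans (^-distrib-* b (x ^ 2) 4) (cong (b ^ 4 *_) (^-assocʳ x 2 4))) ⟩
      (a * x + (b * x) * (b * x)) + (a ^ 4 * x ^ 16 + b ^ 4 * x ^ 8)
                                                                   ≡⟨ solve 7 (λ a b x a⁴ x¹⁶ b⁴ x⁸ →
                                                                         (a :* x :+ (b :* x) :* (b :* x)) :+ (a⁴ :* x¹⁶ :+ b⁴ :* x⁸)
                                                                         := a⁴ :* x¹⁶ :+ b⁴ :* x⁸ :+ b :^ 2 :* x :^ 2 :+ a :* x)
                                                                       refl a b x (a ^ 4) (x ^ 16) (b ^ 4) (x ^ 8) ⟩
      E x                                                          ∎
      where
      open ≡-Reasoning
      s A B : Carrier
      s = a * x ^ 4 + b * x ^ 2
      A = (a * x) ^ (2 ℕ.^ e₂)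
      B = (b * x) ^ (2 ℕ.^ e₁)

    E≡0⇒⟨⟩≡0 : ∀ {x} → E x ≡ 0# → ∀ y → ⟨ x , y ⟩ ≡ 0#
    E≡0⇒⟨⟩≡0 {x} Ex≡0 y = begin
      ⟨ x , y ⟩      ≡⟨ ⟨⟩≡Tr[L*] x y ⟩
      Tr (L x * y)   ≡⟨ cong (λ z → Tr (z * y)) (x^n≡0⇒x≡0 (L x) 4 (trans (L⁴≡E x) Ex≡0)) ⟩
      Tr (0# * y)    ≡⟨ cong Tr (zeroˡ y) ⟩
      Tr 0#          ≡⟨ Tr-0 ⟩
      0#             ∎
      where open ≡-Reasoning

    ⟨⟩≡0⇒E≡0 : ∀ {x} → (∀ y → ⟨ x , y ⟩ ≡ 0#) → E x ≡ 0#
    ⟨⟩≡0⇒E≡0 {x} ⟨x,_⟩≡0 = begin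
      E x       ≡⟨ L⁴≡E x ⟨
      L x ^ 4   ≡⟨ cong (_^ 4) (Tr-nondegenerate 1≤m (L x) (λ y → trans (sym (⟨⟩≡Tr[L*] x y)) (⟨x,_⟩≡0 y))) ⟩
      0# ^ 4    ≡⟨ zeroˡ _ ⟩
      0#        ∎
      where open ≡-Reasoning

    Q̃-k≡0 : ∀ {l} → l ∈k → Q̃ l ≡ 0#
    Q̃-k≡0 l∈k = Tr-k≡0 (+-∈k (+-∈k (*-∈k a∈k (^-∈k 5 l∈k)) (*-∈k b∈k (^-∈k 3 l∈k))) (*-∈k c∈k l∈k))

    ⟨⟩-k≡0 : ∀ {l l′} → l ∈k → l′ ∈k → ⟨ l , l′ ⟩ ≡ 0#
    ⟨⟩-k≡0 l∈k l′∈k = Tr-k≡0 (+-∈k (*-∈k l∈k (R-∈k l′∈k)) (*-∈k l′∈k (R-∈k l∈k)))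
      where
      R-∈k : ∀ {t} → t ∈k → R t ∈k
      R-∈k t∈k = +-∈k (+-∈k (*-∈k a∈k (^-∈k 4 t∈k)) (*-∈k b∈k (^-∈k 2 t∈k))) (*-∈k (^-∈k 2 c∈k) t∈k)

    W-subgroup : IsSubgroup inW
    W-subgroup = record
      { 0∈ = fromWitness E-0
      ; +∈ = λ x∈W y∈W → fromWitness (trans (E-+ _ _)
               (trans (cong₂ _+_ (toWitness x∈W) (toWitness y∈W)) (+-identityˡ 0#)))
      }

    ∈KW⇒ : ∀ {x} → T (inKW x) → ∃[ l ] l ∈k × E (x + l) ≡ 0#
    ∈KW⇒ {x} x∈KW with satisfied (any⁻ _ elems x∈KW)
    ... | l , l∈k∧x-l∈W with Equivalence.to (T-∧ {inK l} {inW (x + - l)}) l∈k∧x-l∈W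
    ... | l∈k , x-l∈W = l , toWitness l∈k , trans (cong (λ z → E (x + z)) (sym (-x≡x l))) (toWitness x-l∈W)

    ∈KW⇐ : ∀ {x l} → l ∈k → E (x + l) ≡ 0# → T (inKW x)
    ∈KW⇐ {x} {l} l∈k x+l∈W = any⁺ _ (AnyList.map (λ { refl → Equivalence.from (T-∧ {inK l} {inW (x + - l)})
      (fromWitness l∈k , fromWitness (trans (cong (λ z → E (x + z)) (-x≡x l)) x+l∈W)) }) (elems-complete l))

    W⊆KW : ∀ {x} → T (inW x) → T (inKW x)
    W⊆KW x∈W = ∈KW⇐ (toWitness (IsSubgroup.0∈ k-subgroup)) (trans (cong E (+-identityʳ _)) (toWitness x∈W))

    k⊆KW : ∀ {l} → T (inK l) → T (inKW l)
    k⊆KW l∈k = ∈KW⇐ (toWitness l∈k) (trans (cong E (x+x≡0 _)) E-0)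

    KW-subgroup : IsSubgroup inKW
    KW-subgroup = record
      { 0∈ = W⊆KW (IsSubgroup.0∈ W-subgroup)
      ; +∈ = +∈KW
      }
      where
      +∈KW : ∀ {x y} → T (inKW x) → T (inKW y) → T (inKW (x + y))
      +∈KW {x} {y} x∈KW y∈KW with ∈KW⇒ x∈KW | ∈KW⇒ y∈KW
      ... | l , l∈k , x+l∈W | l′ , l′∈k , y+l′∈W = ∈KW⇐ (+-∈k l∈k l′∈k) (begin
        E ((x + y) + (l + l′))         ≡⟨ cong E (+-interchange x y l l′) ⟩
        E ((x + l) + (y + l′))         ≡⟨ E-+ _ _ ⟩
        E (x + l) + E (y + l′)         ≡⟨ cong₂ _+_ x+l∈W y+l′∈W ⟩
        0# + 0#                        ≡⟨ +-identityˡ 0# ⟩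
        0#                             ∎)
        where open ≡-Reasoning

    KW⊆U : ∀ {x} → T (inKW x) → T (inU x)
    KW⊆U {x} x∈KW with ∈KW⇒ x∈KW
    ... | l₀ , l₀∈k , x+l₀∈W = vanishesOn⇐ λ {l} l∈k → begin
      ⟨ x , l ⟩                         ≡⟨ cong ⟨_, l ⟩ (x+y+y≡x x l₀) ⟨
      ⟨ (x + l₀) + l₀ , l ⟩             ≡⟨ ⟨⟩-+ˡ (x + l₀) l₀ l ⟩
      ⟨ x + l₀ , l ⟩ + ⟨ l₀ , l ⟩       ≡⟨ cong₂ _+_ (E≡0⇒⟨⟩≡0 x+l₀∈W l) (⟨⟩-k≡0 l₀∈k (toWitness l∈k)) ⟩
      0# + 0#                           ≡⟨ +-identityˡ 0# ⟩
      0#                                ∎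
      where open ≡-Reasoning

    U-subgroup : IsSubgroup inU
    U-subgroup = record
      { 0∈ = KW⊆U (IsSubgroup.0∈ KW-subgroup)
      ; +∈ = λ x∈U y∈U → vanishesOn⇐ λ {l} l∈k → trans (⟨⟩-+ˡ _ _ l)
               (trans (cong₂ _+_ (vanishesOn⇒ x∈U l∈k) (vanishesOn⇒ y∈U l∈k)) (+-identityˡ 0#))
      }

    count-KW*count-U : count inKW ℕ.* count inU ≡ N ℕ.* count inW
    count-KW*count-U = begin
      count inKW ℕ.* count inU                       ≡⟨ cong (count inKW ℕ.*_) (count-cong _ _ elems orthogonal⇔U) ⟨
      count inKW ℕ.* count orthogonal′               ≡⟨ count-orthogonal KW-subgroup B B∈𝔽₂ B-+ˡ B-+ʳ ⟩
      N ℕ.* count (λ x → inKW x ∧ radical′ x)        ≡⟨ cong (N ℕ.*_) (count-cong _ _ elems radical⇔W) ⟩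
      N ℕ.* count inW                                ∎
      where
      open ≡-Reasoning
      B : Carrier → Carrier → Carrier
      B x y = ⟨ y , x ⟩
      B∈𝔽₂ : ∀ x y → Is𝔽₂ (B x y)
      B∈𝔽₂ x y = ⟨⟩∈𝔽₂ y x
      B-+ˡ : ∀ x x′ y → B (x + x′) y ≡ B x y + B x′ y
      B-+ˡ x x′ y = ⟨⟩-+ʳ y x x′
      B-+ʳ : ∀ x y y′ → B x (y + y′) ≡ B x y + B x y′
      B-+ʳ x y y′ = ⟨⟩-+ˡ y y′ x
      orthogonal′ radical′ : Carrier → Bool
      orthogonal′ = orthogonal KW-subgroup B B∈𝔽₂ B-+ˡ B-+ʳ
      radical′ = radical KW-subgroup B B∈𝔽₂ B-+ˡ B-+ʳ
      orthogonal⇔U : ∀ y → T (orthogonal′ y) ⇔ T (inU y)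
      orthogonal⇔U y = mk⇔ (λ y⊥KW → vanishesOn⇐ (vanishesOn⇒ y⊥KW ∘ k⊆KW)) (λ y∈U → vanishesOn⇐ (λ {x} → y⊥KW y∈U))
        where
        y⊥KW : T (inU y) → ∀ {x} → T (inKW x) → ⟨ y , x ⟩ ≡ 0#
        y⊥KW y∈U {x} x∈KW with ∈KW⇒ x∈KW
        ... | l₀ , l₀∈k , x+l₀∈W = begin
          ⟨ y , x ⟩                         ≡⟨ cong ⟨ y ,_⟩ (x+y+y≡x x l₀) ⟨
          ⟨ y , (x + l₀) + l₀ ⟩             ≡⟨ ⟨⟩-+ʳ y (x + l₀) l₀ ⟩
          ⟨ y , x + l₀ ⟩ + ⟨ y , l₀ ⟩       ≡⟨ cong₂ _+_ (trans (⟨⟩-sym y _) (E≡0⇒⟨⟩≡0 x+l₀∈W y))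
                                                         (vanishesOn⇒ y∈U (fromWitness l₀∈k)) ⟩
          0# + 0#                           ≡⟨ +-identityˡ 0# ⟩
          0#                                ∎
      radical⇔W : ∀ x → T (inKW x ∧ radical′ x) ⇔ T (inW x)
      radical⇔W x = mk⇔
        (λ x∈KW∩rad → fromWitness (⟨⟩≡0⇒E≡0 λ y →
           trans (⟨⟩-sym x y) (vanishesOn⇒ (proj₂ (Equivalence.to (T-∧ {inKW x}) x∈KW∩rad)) {y} _)))
        (λ x∈W → Equivalence.from (T-∧ {inKW x}) (W⊆KW x∈W ,
           vanishesOn⇐ λ {y} _ → trans (⟨⟩-sym y x) (E≡0⇒⟨⟩≡0 (toWitness x∈W) y)))

    Q̃-+-k : ∀ x {l} → l ∈k → χ (Q̃ (x + l)) ≡ χ (Q̃ x) *ℤ χ ⟨ x , l ⟩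
    Q̃-+-k x {l} l∈k = begin
      χ (Q̃ (x + l))                ≡⟨ cong χ (Q̃-polar x l) ⟩
      χ (Q̃ x + Q̃ l + ⟨ x , l ⟩)   ≡⟨ cong (λ t → χ (Q̃ x + t + ⟨ x , l ⟩)) (Q̃-k≡0 l∈k) ⟩
      χ (Q̃ x + 0# + ⟨ x , l ⟩)    ≡⟨ cong (λ t → χ (t + ⟨ x , l ⟩)) (+-identityʳ (Q̃ x)) ⟩
      χ (Q̃ x + ⟨ x , l ⟩)         ≡⟨ χ-+ (Tr∈𝔽₂ _) (⟨⟩∈𝔽₂ x l) ⟩
      χ (Q̃ x) *ℤ χ ⟨ x , l ⟩      ∎
      where open ≡-Reasoning

    ∑χQ̃≡∑χQ̃-U : ∑F (χ ∘ Q̃) ≡ ∑F (λ x → 𝟙 (inU x) *ℤ χ (Q̃ x))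
    ∑χQ̃≡∑χQ̃-U = ℤP.*-cancelˡ-≡ (pos K) _ _ ⦃ ℕ.>-nonZero 0<K ⦄ (begin
      pos K *ℤ S                                                        ≡⟨ cong (_*ℤ S) (∑F-𝟙 inK) ⟨
      ∑F (𝟙 ∘ inK) *ℤ S                                                 ≡⟨ ℤP.*-comm _ S ⟩
      S *ℤ ∑F (𝟙 ∘ inK)                                                 ≡⟨ ∑-*ˡ elems S _ ⟨
      ∑F (λ l → S *ℤ 𝟙 (inK l))                                         ≡⟨ ∑-cong elems (λ {l} _ → translate l) ⟩
      ∑F (λ l → ∑F (λ x → 𝟙 (inK l) *ℤ (χ (Q̃ x) *ℤ χ ⟨ x , l ⟩)))       ≡⟨ ∑-comm elems elems _ ⟩
      ∑F (λ x → ∑F (λ l → 𝟙 (inK l) *ℤ (χ (Q̃ x) *ℤ χ ⟨ x , l ⟩)))       ≡⟨ ∑-cong elems (λ {x} _ → pull-out x) ⟩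
      ∑F (λ x → χ (Q̃ x) *ℤ ∑F (λ l → 𝟙 (inK l) *ℤ χ ⟨ x , l ⟩))         ≡⟨ ∑-cong elems (λ {x} _ → cong (χ (Q̃ x) *ℤ_)
                                                                             (∑-character k-subgroup ⟨ x ,_⟩ (λ _ → ⟨⟩∈𝔽₂ x _) (λ _ _ → ⟨⟩-+ʳ x _ _))) ⟩
      ∑F (λ x → χ (Q̃ x) *ℤ (𝟙 (inU x) *ℤ pos K))                       ≡⟨ ∑-cong elems (λ {x} _ → regroup (χ (Q̃ x)) (𝟙 (inU x)) (pos K)) ⟩
      ∑F (λ x → pos K *ℤ (𝟙 (inU x) *ℤ χ (Q̃ x)))                       ≡⟨ ∑-*ˡ elems (pos K) _ ⟩
      pos K *ℤ ∑F (λ x → 𝟙 (inU x) *ℤ χ (Q̃ x))                         ∎)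
      where
      open ≡-Reasoning
      K : ℕ
      K = count inK
      S : ℤ
      S = ∑F (χ ∘ Q̃)
      0<K : 0 < K
      0<K = filter-some (T? ∘ inK) (AnyList.map (λ { refl → IsSubgroup.0∈ k-subgroup }) (elems-complete 0#))
      regroup : ∀ i j k → i *ℤ (j *ℤ k) ≡ k *ℤ (j *ℤ i)
      regroup = ℤ-Solver.solve-∀
      swap-front : ∀ i j k → i *ℤ (j *ℤ k) ≡ j *ℤ (i *ℤ k)
      swap-front = ℤ-Solver.solve-∀
      pull-out : ∀ x → ∑F (λ l → 𝟙 (inK l) *ℤ (χ (Q̃ x) *ℤ χ ⟨ x , l ⟩)) ≡ χ (Q̃ x) *ℤ ∑F (λ l → 𝟙 (inK l) *ℤ χ ⟨ x , l ⟩)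
      pull-out x = trans (∑-cong elems (λ {l} _ → swap-front (𝟙 (inK l)) (χ (Q̃ x)) _)) (∑-*ˡ elems (χ (Q̃ x)) _)
      translate : ∀ l → S *ℤ 𝟙 (inK l) ≡ ∑F (λ x → 𝟙 (inK l) *ℤ (χ (Q̃ x) *ℤ χ ⟨ x , l ⟩))
      translate l with inK l in l∈k?
      ... | false = trans (ℤP.*-zeroʳ S) (sym (∑-0 elems))
      ... | true  = begin
        S *ℤ 1ℤ                                              ≡⟨ ℤP.*-identityʳ S ⟩
        S                                                    ≡⟨ ∑F-shift l (χ ∘ Q̃) ⟩
        ∑F (λ x → χ (Q̃ (x + l)))                             ≡⟨ ∑-cong elems (λ {x} _ → trans (Q̃-+-k x (toWitness (subst T (sym l∈k?) _)))
                                                                                    (sym (ℤP.*-identityˡ _))) ⟩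
        ∑F (λ x → 1ℤ *ℤ (χ (Q̃ x) *ℤ χ ⟨ x , l ⟩))           ∎

    zero-count-equation : 2 ℕ.* count (λ x → isZero (Q̃ x)) ℕ.+ count inU
                          ≡ 2 ℕ.* count (λ x → inU x ∧ isZero (Q̃ x)) ℕ.+ count (λ _ → true)
    zero-count-equation = 2x-a≡2y-b⇒2x+b≡2y+a
      (count (λ x → isZero (Q̃ x))) (count (λ _ → true)) (count (λ x → inU x ∧ isZero (Q̃ x))) (count inU) (begin
      _                                      ≡⟨ ∑-𝟙*χ (λ _ → true) Q̃ ⟨
      ∑F (λ x → 1ℤ *ℤ χ (Q̃ x))               ≡⟨ ∑-cong elems (λ _ → ℤP.*-identityˡ _) ⟩
      ∑F (χ ∘ Q̃)                             ≡⟨ ∑χQ̃≡∑χQ̃-U ⟩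
      ∑F (λ x → 𝟙 (inU x) *ℤ χ (Q̃ x))        ≡⟨ ∑-𝟙*χ inU Q̃ ⟩
      _                                      ∎)
      where open ≡-Reasoning

proposition3p3 : (m : ℕ) → 1 ≤ m → (F : FiniteField4^ m) →
    let open FiniteField4^ F in let open Setup F in
    (a b c : Carrier) → a ^ q ≡ a → a ≢ 0# → b ^ q ≡ b → c ^ q ≡ c →
    let open Forms a b c in
    V≡W →
    (s : Sign) →
    HasSign (count (λ _ → true)) (count inW) (count (λ x → isZero (Q̃ x))) s
    ⇔ HasSign (count inU) (count inKW) (count (λ x → inU x ∧ isZero (Q̃ x))) s
proposition3p3 m 1≤m F a b c a∈k _ b∈k c∈k _ s =
  mk⇔ (HasSign-transfer s |W|-2^ |U|-2^ |KW|-2^ |KW||U|≡|k₂||W| |KW|≤|U| zero-count-equation)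
      (HasSign-transfer s |KW|-2^ |k₂|-2^ |W|-2^ |W||k₂|≡|U||KW| |W|≤|k₂| (sym zero-count-equation))
  where
  open Field F
  open Forms a b c
  open QuadraticForm 1≤m a∈k b∈k c∈k
  |k₂|-2^ : ∃[ j ] count (λ _ → true) ≡ 2 ℕ.^ j
  |k₂|-2^ = 2 ℕ.* m , trans count-everything N≡2^2m
  |W|-2^ : ∃[ j ] count inW ≡ 2 ℕ.^ j
  |W|-2^  = subgroup-count-2^ 1≤m W-subgroup
  |U|-2^ : ∃[ j ] count inU ≡ 2 ℕ.^ j
  |U|-2^  = subgroup-count-2^ 1≤m U-subgroup
  |KW|-2^ : ∃[ j ] count inKW ≡ 2 ℕ.^ j
  |KW|-2^ = subgroup-count-2^ 1≤m KW-subgroup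
  |KW||U|≡|k₂||W| : count inKW ℕ.* count inU ≡ count (λ _ → true) ℕ.* count inW
  |KW||U|≡|k₂||W| = trans count-KW*count-U (cong (ℕ._* count inW) (sym count-everything))
  |W||k₂|≡|U||KW| : count inW ℕ.* count (λ _ → true) ≡ count inU ℕ.* count inKW
  |W||k₂|≡|U||KW| = trans (ℕP.*-comm (count inW) _) (trans (sym |KW||U|≡|k₂||W|) (ℕP.*-comm (count inKW) _))
  |KW|≤|U| : count inKW ≤ count inU
  |KW|≤|U| = count-mono inKW inU elems KW⊆U
  |W|≤|k₂| : count inW ≤ count (λ _ → true)
  |W|≤|k₂| = count-mono inW (λ _ → true) elems (λ _ → _)
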